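{- Let $m\in\mathbb Z$. (i) If $m=N_2(1+(x-1)^5h(x))$ for some $h\in\mathbb Z[x]$ with $3\nmid h(1)$, then there is $F\in\mathbb Z[x]$ with $F(1)=N_1(F)=N_3(F)=3$, $N_2(F)=3m$ and $M_{27}(F)=3^4m$. (ii) If $m=N_3(1+(x-1)^5h(x))$ for some $h\in\mathbb Z[x]$ with $3\nmid h(1)$, then there is $F\in\mathbb Z[x]$ with $F(1)=N_1(F)=N_2(F)=3$, $N_3(F)=3m$ and $M_{27}(F)=3^4m$.
   Context: $M_{27}(F)=\prod_{z^{27}=1}F(z)$. For $k\geq1$, $\omega_k=e^{2\pi i/3^k}$ and for $G\in\mathbb Z[x]$, $N_k(G)=\prod_{1\le j\le 3^k,\ 3\nmid j}G(\omega_k^j)$. -}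

module Defs where

open import Data.Nat as ℕ using (ℕ; zero; suc)
open import Data.Nat.DivMod using (_%_)
open import Data.Bool using (Bool; not)
open import Data.Integer using (ℤ; +_; -_; _+_; _*_)
open import Data.List as List using (List; []; _∷_; foldr; map; upTo; filterᵇ)
open import Data.Vec as Vec using (Vec; []; _∷_)

-- Integer polynomials: coefficient lists, lowest degree first.

Poly : Set
Poly = List ℤ

padd : Poly → Poly → Poly
padd [] q = q
padd (a ∷ p) [] = a ∷ p
padd (a ∷ p) (b ∷ q) = (a + b) ∷ padd p q

pscale : ℤ → Poly → Poly
pscale c = map (c *_)

pmul : Poly → Poly → Poly
pmul [] q = []
pmul (a ∷ p) q = padd (pscale a q) (+ 0 ∷ pmul p q)

ppow : Poly → ℕ → Poly
ppow p zero = + 1 ∷ []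
ppow p (suc n) = pmul p (ppow p n)

xMinus1 : Poly
xMinus1 = - (+ 1) ∷ + 1 ∷ []

evalℤ : Poly → ℤ → ℤ
evalℤ p z = foldr (λ c acc → c + z * acc) (+ 0) p

-- The ring ℤ[ζ] with ζ = e^{2πi/27}, realised as ℤ[x]/(Φ₂₇(x)),
-- Φ₂₇(x) = x^18 + x^9 + 1.  Elements are their unique representatives
-- of degree < 18 (coefficient vectors, lowest degree first), so
-- propositional equality of vectors is equality in ℤ[ζ₂₇] ⊂ ℂ.

Zζ : Set
Zζ = Vec ℤ 18

const : ℤ → Zζ
const c = c ∷ Vec.replicate 17 (+ 0)

zeroζ : Zζ
zeroζ = const (+ 0)

oneζ : Zζ
oneζ = const (+ 1)

addζ : Zζ → Zζ → Zζ
addζ = Vec.zipWith _+_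

scaleζ : ℤ → Zζ → Zζ
scaleζ c = Vec.map (c *_)

-- multiplication by ζ, using ζ^18 = - ζ^9 - 1
mulζ : Zζ → Zζ
mulζ v = addζ (+ 0 ∷ Vec.init v) (scaleζ (- Vec.last v) wrap)
  where
  wrap : Zζ
  wrap = + 1 ∷ + 0 ∷ + 0 ∷ + 0 ∷ + 0 ∷ + 0 ∷ + 0 ∷ + 0 ∷ + 0 ∷
         + 1 ∷ + 0 ∷ + 0 ∷ + 0 ∷ + 0 ∷ + 0 ∷ + 0 ∷ + 0 ∷ + 0 ∷ []

mulR : Zζ → Zζ → Zζ
mulR a b = Vec.foldr (λ _ → Zζ) (λ ai acc → addζ (scaleζ ai b) (mulζ acc)) zeroζ a

powR : Zζ → ℕ → Zζ
powR z zero = oneζ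
powR z (suc n) = mulR z (powR z n)

ζ : Zζ
ζ = + 0 ∷ + 1 ∷ Vec.replicate 16 (+ 0)

evalR : Poly → Zζ → Zζ
evalR p z = foldr (λ c acc → addζ (const c) (mulR z acc)) zeroζ p

prodR : List Zζ → Zζ
prodR = foldr mulR oneζ

-- Norms.
-- For 1 ≤ k ≤ 3, ω_k = e^{2πi/3^k} = ζ^(3^(3-k)), and
-- N_k(G) = ∏_{1 ≤ j ≤ 3^k, 3 ∤ j} G(ω_k^j).
-- (Only meaningful for k ∈ {1,2,3}, the only values used.)

N : ℕ → Poly → Zζ
N k G = prodR (map (λ j → evalR G (powR ζ (3 ℕ.^ (3 ℕ.∸ k) ℕ.* j)))
                   (filterᵇ (λ j → not (j % 3 ℕ.≡ᵇ 0)) (map suc (upTo (3 ℕ.^ k)))))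

M27 : Poly → Zζ
M27 F = prodR (map (λ j → evalR F (powR ζ j)) (upTo 27))

G5 : Poly → Poly
G5 h = padd (+ 1 ∷ []) (pmul (ppow xMinus1 5) h)

{-# OPTIONS --safe #-}
module Submission where

-- Write u = x − 1 and split h = ρ + 3σ + u³t with ρ = r₀ + r₁u + r₂u², rᵢ ∈ {0, 1, 2}; then r₀ ≢ 0
-- since 3 ∤ h(1). For the prescribed level k ∈ {2, 3} let Φ be the cyclotomic polynomial of order 3ᵏ
-- and T the product of the other cyclotomic factors of x²⁷ − 1. For each of the 18 residues ρ there
-- are ε and Q such that seed = (1 − x)ε·G5(ρ) + ΦQ takes the value 3 at 1 and has norm 3 at the two
-- other levels, while N_k((1 − x)ε) = 3. Polynomials Eₛ, Eₜ with TEₛ ≡ −3u⁶ and TEₜ ≡ −u⁹ modulo Φ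
-- absorb the rest of h: since G5(h) = G5(ρ) + 3u⁵σ + u⁸t, the polynomial
-- F = seed + εT(σEₛ + tEₜ) agrees with seed at the roots of T and with (1 − x)ε·G5(h) at the roots
-- of Φ. Hence N_k(F) = 3m, the other two norms are 3, and M₂₇(F), the product of F(1) and the three
-- norms, is 3⁴m. All numerical facts are checked by evaluation in ℤ[ζ₂₇].

open import Defs
open import Data.Integer using (ℤ; +_; -_; -[1+_]; _+_; _*_)
open import Data.Integer.Divisibility using (_∣_)
open import Data.Product using (Σ; _×_; _,_; proj₁; proj₂)
open import Relation.Nullary using (¬_; Dec; yes; no)
open import Relation.Binary.PropositionalEquality
  using (_≡_; _≢_; refl; sym; trans; cong; cong₂; subst; module ≡-Reasoning)

open import Algebra.Bundles using (CommutativeRing)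
open import Algebra.Structures {A = Zζ} _≡_ using (IsCommutativeRing)
open import Algebra.Solver.Ring.AlmostCommutativeRing using (fromCommutativeRing; _-Raw-AlmostCommutative⟶_)
import Algebra.Solver.Ring as RingSolver
open import Data.Bool using (Bool; true; false; not; if_then_else_)
open import Data.Empty using (⊥-elim)
open import Data.Fin as Fin using (Fin; toℕ; fromℕ<)
import Data.Fin.Properties as Fin
open import Data.Fin.Patterns using (0F; 1F; 2F)
import Data.Integer.Divisibility.Signed as Signed
open import Data.Integer.DivMod using (_%ℕ_; _/ℕ_; n%ℕd<d; a≡a%ℕn+[a/ℕn]*n)
import Data.Integer.Properties as ℤ
open import Data.List as List using (List; []; _∷_; _++_)
import Data.List.Properties as List
open import Data.List.Relation.Unary.All as All using (All)
open import Data.List.Relation.Binary.Permutation.Propositional using (_↭_; ↭-sym; ↭-trans; ↭⇒↭ₛ)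
open import Data.List.Relation.Binary.Permutation.Propositional.Properties using (map⁺)
open import Data.Maybe using (Maybe; just; nothing)
open import Data.Nat as ℕ using (ℕ; zero; suc)
open import Data.Nat.DivMod using (_%_; m%n<n; %-distribˡ-+)
import Data.Nat.Properties as ℕₚ
open import Data.List.Sort.InsertionSort.Base ℕₚ.≤-decTotalOrder using (sort)
open import Data.List.Sort.InsertionSort.Properties ℕₚ.≤-decTotalOrder using (sort-↭)
open import Data.Vec as Vec using (Vec; []; _∷_)
import Data.Vec.Properties as Vec
open import Function using (id; _∘_)
open import Function.Strict using (force; force-≡)
open import Relation.Binary.Definitions using (DecidableEquality)
import Relation.Binary.PropositionalEquality as ≡
open import Data.List.Relation.Binary.Permutation.Setoid.Properties (≡.setoid Zζ) using (foldr-commMonoid)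
open import Relation.Nullary.Decidable using (from-yes)

open ≡-Reasoning

private
  variable
    A B C : Set
    m n : ℕ

-- Arithmetic in ℤ[ζ]

init-zipWith : ∀ (f : A → B → C) (u : Vec A (suc n)) v →
               Vec.init (Vec.zipWith f u v) ≡ Vec.zipWith f (Vec.init u) (Vec.init v)
init-zipWith {n = zero}  f (x ∷ []) (y ∷ []) = refl
init-zipWith {n = suc n} f (x ∷ u)  (y ∷ v)  = cong (f x y ∷_) (init-zipWith f u v)

last-zipWith : ∀ (f : A → B → C) (u : Vec A (suc n)) v →
               Vec.last (Vec.zipWith f u v) ≡ f (Vec.last u) (Vec.last v)
last-zipWith {n = zero}  f (x ∷ []) (y ∷ []) = refl
last-zipWith {n = suc n} f (x ∷ u)  (y ∷ v)  = last-zipWith f u v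

init-map : ∀ (f : A → B) (u : Vec A (suc n)) → Vec.init (Vec.map f u) ≡ Vec.map f (Vec.init u)
init-map {n = zero}  f (x ∷ []) = refl
init-map {n = suc n} f (x ∷ u)  = cong (f x ∷_) (init-map f u)

last-map : ∀ (f : A → B) (u : Vec A (suc n)) → Vec.last (Vec.map f u) ≡ f (Vec.last u)
last-map {n = zero}  f (x ∷ []) = refl
last-map {n = suc n} f (x ∷ u)  = last-map f u

zeroᵛ : Vec ℤ n
zeroᵛ = Vec.replicate _ (+ 0)

addᵛ : Vec ℤ n → Vec ℤ n → Vec ℤ n
addᵛ = Vec.zipWith _+_

scaleᵛ : ℤ → Vec ℤ n → Vec ℤ n
scaleᵛ c = Vec.map (c *_)

addᵛ-assoc : ∀ (u v w : Vec ℤ n) → addᵛ (addᵛ u v) w ≡ addᵛ u (addᵛ v w)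
addᵛ-assoc = Vec.zipWith-assoc ℤ.+-assoc

addᵛ-comm : ∀ (u v : Vec ℤ n) → addᵛ u v ≡ addᵛ v u
addᵛ-comm = Vec.zipWith-comm ℤ.+-comm

addᵛ-identityˡ : ∀ (v : Vec ℤ n) → addᵛ zeroᵛ v ≡ v
addᵛ-identityˡ = Vec.zipWith-identityˡ ℤ.+-identityˡ

addᵛ-identityʳ : ∀ (v : Vec ℤ n) → addᵛ v zeroᵛ ≡ v
addᵛ-identityʳ = Vec.zipWith-identityʳ ℤ.+-identityʳ

addᵛ-interchange : ∀ (a b c d : Vec ℤ n) → addᵛ (addᵛ a b) (addᵛ c d) ≡ addᵛ (addᵛ a c) (addᵛ b d)
addᵛ-interchange a b c d = begin
  addᵛ (addᵛ a b) (addᵛ c d)  ≡⟨ addᵛ-assoc a b (addᵛ c d) ⟩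
  addᵛ a (addᵛ b (addᵛ c d))  ≡⟨ cong (addᵛ a) (sym (addᵛ-assoc b c d)) ⟩
  addᵛ a (addᵛ (addᵛ b c) d)  ≡⟨ cong (λ x → addᵛ a (addᵛ x d)) (addᵛ-comm b c) ⟩
  addᵛ a (addᵛ (addᵛ c b) d)  ≡⟨ cong (addᵛ a) (addᵛ-assoc c b d) ⟩
  addᵛ a (addᵛ c (addᵛ b d))  ≡⟨ sym (addᵛ-assoc a c (addᵛ b d)) ⟩
  addᵛ (addᵛ a c) (addᵛ b d)  ∎

scaleᵛ-distribˡ : ∀ c (u v : Vec ℤ n) → scaleᵛ c (addᵛ u v) ≡ addᵛ (scaleᵛ c u) (scaleᵛ c v)
scaleᵛ-distribˡ c []      []      = refl
scaleᵛ-distribˡ c (x ∷ u) (y ∷ v) = cong₂ _∷_ (ℤ.*-distribˡ-+ c x y) (scaleᵛ-distribˡ c u v)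

scaleᵛ-distribʳ : ∀ c d (v : Vec ℤ n) → scaleᵛ (c + d) v ≡ addᵛ (scaleᵛ c v) (scaleᵛ d v)
scaleᵛ-distribʳ c d []      = refl
scaleᵛ-distribʳ c d (x ∷ v) = cong₂ _∷_ (ℤ.*-distribʳ-+ x c d) (scaleᵛ-distribʳ c d v)

scaleᵛ-assoc : ∀ c d (v : Vec ℤ n) → scaleᵛ c (scaleᵛ d v) ≡ scaleᵛ (c * d) v
scaleᵛ-assoc c d []      = refl
scaleᵛ-assoc c d (x ∷ v) = cong₂ _∷_ (sym (ℤ.*-assoc c d x)) (scaleᵛ-assoc c d v)

scaleᵛ-comm : ∀ c d (v : Vec ℤ n) → scaleᵛ c (scaleᵛ d v) ≡ scaleᵛ d (scaleᵛ c v)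
scaleᵛ-comm c d v = begin
  scaleᵛ c (scaleᵛ d v)  ≡⟨ scaleᵛ-assoc c d v ⟩
  scaleᵛ (c * d) v       ≡⟨ cong (λ e → scaleᵛ e v) (ℤ.*-comm c d) ⟩
  scaleᵛ (d * c) v       ≡⟨ sym (scaleᵛ-assoc d c v) ⟩
  scaleᵛ d (scaleᵛ c v)  ∎

scaleᵛ-identityˡ : ∀ (v : Vec ℤ n) → scaleᵛ (+ 1) v ≡ v
scaleᵛ-identityˡ []      = refl
scaleᵛ-identityˡ (x ∷ v) = cong₂ _∷_ (ℤ.*-identityˡ x) (scaleᵛ-identityˡ v)

scaleᵛ-zeroˡ : ∀ (v : Vec ℤ n) → scaleᵛ (+ 0) v ≡ zeroᵛ
scaleᵛ-zeroˡ []      = refl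
scaleᵛ-zeroˡ (x ∷ v) = cong (+ 0 ∷_) (scaleᵛ-zeroˡ v)

scaleᵛ-zeroʳ : ∀ c → scaleᵛ c zeroᵛ ≡ zeroᵛ {n}
scaleᵛ-zeroʳ {zero}  c = refl
scaleᵛ-zeroʳ {suc n} c = cong₂ _∷_ (ℤ.*-zeroʳ c) (scaleᵛ-zeroʳ c)

negζ : Zζ → Zζ
negζ = Vec.map -_

scaleζ-neg1 : ∀ v → scaleζ (- + 1) v ≡ negζ v
scaleζ-neg1 = Vec.map-cong ℤ.-1*i≡-i

shiftζ : Zζ → Zζ
shiftζ v = + 0 ∷ Vec.init v

onePlusζ⁹ : Zζ
onePlusζ⁹ = + 1 ∷ zeroᵛ {8} Vec.++ + 1 ∷ zeroᵛ

-- ζ times the ζ¹⁷-term of v, rewritten with ζ¹⁸ = −(1 + ζ⁹)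
overflowζ : Zζ → Zζ
overflowζ v = scaleζ (- Vec.last v) onePlusζ⁹

shiftζ-addζ : ∀ u v → shiftζ (addζ u v) ≡ addζ (shiftζ u) (shiftζ v)
shiftζ-addζ u v = cong (+ 0 ∷_) (init-zipWith _+_ u v)

shiftζ-scaleζ : ∀ c v → shiftζ (scaleζ c v) ≡ scaleζ c (shiftζ v)
shiftζ-scaleζ c v = cong₂ _∷_ (sym (ℤ.*-zeroʳ c)) (init-map (c *_) v)

overflowζ-addζ : ∀ u v → overflowζ (addζ u v) ≡ addζ (overflowζ u) (overflowζ v)
overflowζ-addζ u v = begin
  scaleζ (- Vec.last (addζ u v)) W             ≡⟨ cong (λ l → scaleζ (- l) W) (last-zipWith _+_ u v) ⟩
  scaleζ (- (Vec.last u + Vec.last v)) W       ≡⟨ cong (λ c → scaleζ c W) (ℤ.neg-distrib-+ (Vec.last u) (Vec.last v)) ⟩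
  scaleζ (- Vec.last u + - Vec.last v) W       ≡⟨ scaleᵛ-distribʳ (- Vec.last u) (- Vec.last v) W ⟩
  addζ (overflowζ u) (overflowζ v)             ∎
  where
  W = onePlusζ⁹

overflowζ-scaleζ : ∀ c v → overflowζ (scaleζ c v) ≡ scaleζ c (overflowζ v)
overflowζ-scaleζ c v = begin
  scaleζ (- Vec.last (scaleζ c v)) W           ≡⟨ cong (λ l → scaleζ (- l) W) (last-map (c *_) v) ⟩
  scaleζ (- (c * Vec.last v)) W                ≡⟨ cong (λ d → scaleζ d W) (ℤ.neg-distribʳ-* c (Vec.last v)) ⟩
  scaleζ (c * - Vec.last v) W                  ≡⟨ sym (scaleᵛ-assoc c (- Vec.last v) W) ⟩
  scaleζ c (overflowζ v)                       ∎
  where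
  W = onePlusζ⁹

mulζ-addζ : ∀ u v → mulζ (addζ u v) ≡ addζ (mulζ u) (mulζ v)
mulζ-addζ u v = begin
  addζ (shiftζ (addζ u v)) (overflowζ (addζ u v))
    ≡⟨ cong₂ addζ (shiftζ-addζ u v) (overflowζ-addζ u v) ⟩
  addζ (addζ (shiftζ u) (shiftζ v)) (addζ (overflowζ u) (overflowζ v))
    ≡⟨ addᵛ-interchange (shiftζ u) (shiftζ v) (overflowζ u) (overflowζ v) ⟩
  addζ (mulζ u) (mulζ v) ∎

mulζ-scaleζ : ∀ c v → mulζ (scaleζ c v) ≡ scaleζ c (mulζ v)
mulζ-scaleζ c v = begin
  addζ (shiftζ (scaleζ c v)) (overflowζ (scaleζ c v))
    ≡⟨ cong₂ addζ (shiftζ-scaleζ c v) (overflowζ-scaleζ c v) ⟩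
  addζ (scaleζ c (shiftζ v)) (scaleζ c (overflowζ v))
    ≡⟨ sym (scaleᵛ-distribˡ c (shiftζ v) (overflowζ v)) ⟩
  scaleζ c (mulζ v) ∎

record IsζLinear (L : Zζ → Zζ) : Set where
  field
    additive    : ∀ u v → L (addζ u v) ≡ addζ (L u) (L v)
    homogeneous : ∀ c u → L (scaleζ c u) ≡ scaleζ c (L u)
    commutes-ζ  : ∀ u → L (mulζ u) ≡ mulζ (L u)

  preserves-zero : L zeroζ ≡ zeroζ
  preserves-zero = begin
    L zeroζ                 ≡⟨ cong L (sym (scaleᵛ-zeroˡ zeroζ)) ⟩
    L (scaleζ (+ 0) zeroζ)  ≡⟨ homogeneous (+ 0) zeroζ ⟩
    scaleζ (+ 0) (L zeroζ)  ≡⟨ scaleᵛ-zeroˡ (L zeroζ) ⟩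
    zeroζ                   ∎

open IsζLinear

mulζ-isζLinear : IsζLinear mulζ
mulζ-isζLinear = record { additive = mulζ-addζ ; homogeneous = mulζ-scaleζ ; commutes-ζ = λ _ → refl }

scaleζ-isζLinear : ∀ c → IsζLinear (scaleζ c)
scaleζ-isζLinear c = record
  { additive    = scaleᵛ-distribˡ c
  ; homogeneous = scaleᵛ-comm c
  ; commutes-ζ  = λ u → sym (mulζ-scaleζ c u)
  }

-- mulR a b = horner a b is Horner's scheme for a(ζ)·b; every ζ-linear map commutes with it, which
-- yields commutativity and associativity of mulR once its right identity is known.
horner : Vec ℤ n → Zζ → Zζ
horner a b = Vec.foldr (λ _ → Zζ) (λ aᵢ acc → addζ (scaleζ aᵢ b) (mulζ acc)) zeroζ a

combination : Vec ℤ n → Vec (Vec ℤ m) n → Vec ℤ m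
combination []       []       = zeroᵛ
combination (x ∷ xs) (v ∷ vs) = addᵛ (scaleᵛ x v) (combination xs vs)

module _ {L : Zζ → Zζ} (L-linear : IsζLinear L) where

  horner-commutes : ∀ (a : Vec ℤ n) b → L (horner a b) ≡ horner a (L b)
  horner-commutes []      b = preserves-zero L-linear
  horner-commutes (x ∷ a) b = begin
    L (addζ (scaleζ x b) (mulζ (horner a b)))
      ≡⟨ additive L-linear (scaleζ x b) (mulζ (horner a b)) ⟩
    addζ (L (scaleζ x b)) (L (mulζ (horner a b)))
      ≡⟨ cong₂ addζ (homogeneous L-linear x b) (commutes-ζ L-linear (horner a b)) ⟩
    addζ (scaleζ x (L b)) (mulζ (L (horner a b)))
      ≡⟨ cong (λ y → addζ (scaleζ x (L b)) (mulζ y)) (horner-commutes a b) ⟩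
    horner (x ∷ a) (L b) ∎

  combination-commutes : ∀ (a : Vec ℤ n) vs → L (combination a vs) ≡ combination a (Vec.map L vs)
  combination-commutes []      []       = preserves-zero L-linear
  combination-commutes (x ∷ a) (v ∷ vs) = begin
    L (addζ (scaleζ x v) (combination a vs))
      ≡⟨ additive L-linear (scaleζ x v) (combination a vs) ⟩
    addζ (L (scaleζ x v)) (L (combination a vs))
      ≡⟨ cong₂ addζ (homogeneous L-linear x v) (combination-commutes a vs) ⟩
    combination (x ∷ a) (Vec.map L (v ∷ vs)) ∎

horner-additive : ∀ (a : Vec ℤ n) u v → horner a (addζ u v) ≡ addζ (horner a u) (horner a v)
horner-additive []      u v = refl
horner-additive (x ∷ a) u v = begin
  addζ (scaleζ x (addζ u v)) (mulζ (horner a (addζ u v)))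
    ≡⟨ cong₂ (λ p q → addζ p (mulζ q)) (scaleᵛ-distribˡ x u v) (horner-additive a u v) ⟩
  addζ (addζ (scaleζ x u) (scaleζ x v)) (mulζ (addζ (horner a u) (horner a v)))
    ≡⟨ cong (addζ (addζ (scaleζ x u) (scaleζ x v))) (mulζ-addζ (horner a u) (horner a v)) ⟩
  addζ (addζ (scaleζ x u) (scaleζ x v)) (addζ (mulζ (horner a u)) (mulζ (horner a v)))
    ≡⟨ addᵛ-interchange (scaleζ x u) (scaleζ x v) (mulζ (horner a u)) (mulζ (horner a v)) ⟩
  addζ (horner (x ∷ a) u) (horner (x ∷ a) v) ∎

horner-isζLinear : ∀ (a : Vec ℤ n) → IsζLinear (horner a)
horner-isζLinear a = record
  { additive    = horner-additive a
  ; homogeneous = λ c u → sym (horner-commutes (scaleζ-isζLinear c) a u)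
  ; commutes-ζ  = λ u → sym (horner-commutes mulζ-isζLinear a u)
  }

ζ-orbit : (n : ℕ) → Zζ → Vec Zζ n
ζ-orbit zero    c = []
ζ-orbit (suc n) c = c ∷ ζ-orbit n (mulζ c)

map-mulζ-ζ-orbit : ∀ n c → Vec.map mulζ (ζ-orbit n c) ≡ ζ-orbit n (mulζ c)
map-mulζ-ζ-orbit zero    c = refl
map-mulζ-ζ-orbit (suc n) c = cong (mulζ c ∷_) (map-mulζ-ζ-orbit n (mulζ c))

horner≡combination-ζ-orbit : ∀ (a : Vec ℤ n) c → horner a c ≡ combination a (ζ-orbit n c)
horner≡combination-ζ-orbit         []      c = refl
horner≡combination-ζ-orbit {suc n} (x ∷ a) c = cong (addζ (scaleζ x c)) (begin
  mulζ (horner a c)                           ≡⟨ cong mulζ (horner≡combination-ζ-orbit a c) ⟩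
  mulζ (combination a (ζ-orbit n c))          ≡⟨ combination-commutes mulζ-isζLinear a (ζ-orbit n c) ⟩
  combination a (Vec.map mulζ (ζ-orbit n c))  ≡⟨ cong (combination a) (map-mulζ-ζ-orbit n c) ⟩
  combination a (ζ-orbit n (mulζ c))          ∎)

standardBasis : (n : ℕ) → Vec (Vec ℤ n) n
standardBasis zero    = []
standardBasis (suc n) = (+ 1 ∷ zeroᵛ) ∷ Vec.map (+ 0 ∷_) (standardBasis n)

combination-shift : ∀ (a : Vec ℤ n) (vs : Vec (Vec ℤ m) n) →
                    combination a (Vec.map (+ 0 ∷_) vs) ≡ + 0 ∷ combination a vs
combination-shift []      []       = refl
combination-shift (x ∷ a) (v ∷ vs) = begin
  addᵛ (x * + 0 ∷ scaleᵛ x v) (combination a (Vec.map (+ 0 ∷_) vs))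
    ≡⟨ cong (addᵛ (x * + 0 ∷ scaleᵛ x v)) (combination-shift a vs) ⟩
  x * + 0 + + 0 ∷ addᵛ (scaleᵛ x v) (combination a vs)
    ≡⟨ cong (λ y → y + + 0 ∷ addᵛ (scaleᵛ x v) (combination a vs)) (ℤ.*-zeroʳ x) ⟩
  + 0 ∷ combination (x ∷ a) (v ∷ vs) ∎

combination-standardBasis : ∀ (a : Vec ℤ n) → combination a (standardBasis n) ≡ a
combination-standardBasis         []      = refl
combination-standardBasis {suc n} (x ∷ a) = begin
  addᵛ (x * + 1 ∷ scaleᵛ x zeroᵛ) (combination a (Vec.map (+ 0 ∷_) (standardBasis n)))
    ≡⟨ cong (addᵛ (x * + 1 ∷ scaleᵛ x zeroᵛ)) (combination-shift a (standardBasis n)) ⟩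
  x * + 1 + + 0 ∷ addᵛ (scaleᵛ x zeroᵛ) (combination a (standardBasis n))
    ≡⟨ cong₂ _∷_ (trans (ℤ.+-identityʳ (x * + 1)) (ℤ.*-identityʳ x))
                 (trans (cong (λ w → addᵛ w (combination a (standardBasis n))) (scaleᵛ-zeroʳ x))
                        (trans (addᵛ-identityˡ (combination a (standardBasis n))) (combination-standardBasis a))) ⟩
  x ∷ a ∎

mulR-identityʳ : ∀ a → mulR a oneζ ≡ a
mulR-identityʳ a = begin
  horner a oneζ                     ≡⟨ horner≡combination-ζ-orbit a oneζ ⟩
  combination a (ζ-orbit 18 oneζ)   ≡⟨⟩
  combination a (standardBasis 18)  ≡⟨ combination-standardBasis a ⟩
  a                                 ∎

horner-zeroᵛ : ∀ n b → horner (zeroᵛ {n}) b ≡ zeroζ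
horner-zeroᵛ zero    b = refl
horner-zeroᵛ (suc n) b = cong₂ (λ p q → addζ p (mulζ q)) (scaleᵛ-zeroˡ b) (horner-zeroᵛ n b)

mulR-const : ∀ c b → mulR (const c) b ≡ scaleζ c b
mulR-const c b = begin
  addζ (scaleζ c b) (mulζ (horner (zeroᵛ {17}) b))  ≡⟨ cong (λ q → addζ (scaleζ c b) (mulζ q)) (horner-zeroᵛ 17 b) ⟩
  addζ (scaleζ c b) zeroζ                           ≡⟨ addᵛ-identityʳ (scaleζ c b) ⟩
  scaleζ c b                                        ∎

mulR-ζ : ∀ b → mulR ζ b ≡ mulζ b
mulR-ζ b = begin
  addζ (scaleζ (+ 0) b) (mulζ (addζ (scaleζ (+ 1) b) (mulζ (horner (zeroᵛ {16}) b))))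
    ≡⟨ cong₂ (λ p q → addζ p (mulζ (addζ (scaleζ (+ 1) b) (mulζ q)))) (scaleᵛ-zeroˡ b) (horner-zeroᵛ 16 b) ⟩
  addζ zeroζ (mulζ (addζ (scaleζ (+ 1) b) zeroζ))
    ≡⟨ addᵛ-identityˡ (mulζ (addζ (scaleζ (+ 1) b) zeroζ)) ⟩
  mulζ (addζ (scaleζ (+ 1) b) zeroζ)
    ≡⟨ cong mulζ (trans (addᵛ-identityʳ (scaleζ (+ 1) b)) (scaleᵛ-identityˡ b)) ⟩
  mulζ b ∎

mulR-identityˡ : ∀ b → mulR oneζ b ≡ b
mulR-identityˡ b = trans (mulR-const (+ 1) b) (scaleᵛ-identityˡ b)

mulR-comm : ∀ a b → mulR a b ≡ mulR b a
mulR-comm a b = begin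
  horner a b              ≡⟨ cong (horner a) (sym (mulR-identityʳ b)) ⟩
  horner a (mulR b oneζ)  ≡⟨ sym (horner-commutes (horner-isζLinear b) a oneζ) ⟩
  mulR b (mulR a oneζ)    ≡⟨ cong (mulR b) (mulR-identityʳ a) ⟩
  mulR b a                ∎

mulR-assoc : ∀ a b c → mulR (mulR a b) c ≡ mulR a (mulR b c)
mulR-assoc a b c = begin
  mulR (mulR a b) c    ≡⟨ mulR-comm (mulR a b) c ⟩
  mulR c (horner a b)  ≡⟨ horner-commutes (horner-isζLinear c) a b ⟩
  mulR a (mulR c b)    ≡⟨ cong (mulR a) (mulR-comm c b) ⟩
  mulR a (mulR b c)    ∎

mulR-zeroʳ : ∀ a → mulR a zeroζ ≡ zeroζ
mulR-zeroʳ a = preserves-zero (horner-isζLinear a)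

mulR-distribˡ : ∀ a u v → mulR a (addζ u v) ≡ addζ (mulR a u) (mulR a v)
mulR-distribˡ = horner-additive

mulR-distribʳ : ∀ a u v → mulR (addζ u v) a ≡ addζ (mulR u a) (mulR v a)
mulR-distribʳ a u v = begin
  mulR (addζ u v) a           ≡⟨ mulR-comm (addζ u v) a ⟩
  mulR a (addζ u v)           ≡⟨ mulR-distribˡ a u v ⟩
  addζ (mulR a u) (mulR a v)  ≡⟨ cong₂ addζ (mulR-comm a u) (mulR-comm a v) ⟩
  addζ (mulR u a) (mulR v a)  ∎

Zζ-isCommutativeRing : IsCommutativeRing addζ mulR negζ zeroζ oneζ
Zζ-isCommutativeRing = record
  { isRing = record
    { +-isAbelianGroup = record
      { isGroup = record
        { isMonoid = record
          { isSemigroup = record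
            { isMagma = record { isEquivalence = ≡.isEquivalence ; ∙-cong = cong₂ addζ }
            ; assoc   = addᵛ-assoc
            }
          ; identity = addᵛ-identityˡ , addᵛ-identityʳ
          }
        ; inverse = Vec.zipWith-inverseˡ ℤ.+-inverseˡ , Vec.zipWith-inverseʳ ℤ.+-inverseʳ
        ; ⁻¹-cong = cong negζ
        }
      ; comm = addᵛ-comm
      }
    ; *-cong     = cong₂ mulR
    ; *-assoc    = mulR-assoc
    ; *-identity = mulR-identityˡ , mulR-identityʳ
    ; distrib    = mulR-distribˡ , mulR-distribʳ
    }
  ; *-comm = mulR-comm
  }

Zζ-commutativeRing : CommutativeRing _ _
Zζ-commutativeRing = record { isCommutativeRing = Zζ-isCommutativeRing }

const-* : ∀ a b → const (a * b) ≡ mulR (const a) (const b)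
const-* a b = begin
  const (a * b)             ≡⟨ cong (a * b ∷_) (sym (scaleᵛ-zeroʳ a)) ⟩
  scaleζ a (const b)        ≡⟨ sym (mulR-const a (const b)) ⟩
  mulR (const a) (const b)  ∎

const-homomorphism : CommutativeRing.rawRing ℤ.+-*-commutativeRing
                     -Raw-AlmostCommutative⟶ fromCommutativeRing Zζ-commutativeRing
const-homomorphism = record
  { ⟦_⟧    = const
  ; +-homo = λ _ _ → refl
  ; *-homo = const-*
  ; -‿homo = λ _ → refl
  ; 0-homo = refl
  ; 1-homo = refl
  }

const-≟ : ∀ a b → Maybe (const a ≡ const b)
const-≟ a b with a ℤ.≟ b
... | yes a≡b = just (cong const a≡b)
... | no  _   = nothing

open RingSolver (CommutativeRing.rawRing ℤ.+-*-commutativeRing) (fromCommutativeRing Zζ-commutativeRing)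
                const-homomorphism const-≟
  using (solve; _:=_; _:+_; _:*_; _:^_; :-_; con)

const-injective : ∀ {a b} → const a ≡ const b → a ≡ b
const-injective = cong Vec.head

mulR-consts : ∀ {x y a b} → x ≡ const a → y ≡ const b → mulR x y ≡ const (a * b)
mulR-consts {a = a} {b} x≡a y≡b = trans (cong₂ mulR x≡a y≡b) (sym (const-* a b))

mulR-by-zero : ∀ {w} → w ≡ zeroζ → ∀ b → mulR w b ≡ zeroζ
mulR-by-zero {w} w≡0 b = trans (mulR-comm w b) (trans (cong (mulR b) w≡0) (mulR-zeroʳ b))

-- Agda unfolds mulR when it compares or normalises terms whose first argument is a concrete vector
-- such as ζ or const c, which takes exponential time. Such facts are therefore proved at a variable
-- point and instantiated afterwards (this lemma and powR-suc exist for that reason), and record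
-- fields below use scaleζ c rather than mulR (const c).
mulR-by-const : ∀ {w c} → w ≡ const c → ∀ b → mulR w b ≡ scaleζ c b
mulR-by-const {w} {c} w≡c b = trans (cong (λ v → mulR v b) w≡c) (mulR-const c b)

powR-suc : ∀ z n → powR z (suc n) ≡ mulR z (powR z n)
powR-suc z n = refl

powR-+ : ∀ z a b → powR z (a ℕ.+ b) ≡ mulR (powR z a) (powR z b)
powR-+ z zero    b = sym (mulR-identityˡ (powR z b))
powR-+ z (suc a) b = trans (cong (mulR z) (powR-+ z a b)) (sym (mulR-assoc z (powR z a) (powR z b)))

evalR-padd : ∀ p q z → evalR (padd p q) z ≡ addζ (evalR p z) (evalR q z)
evalR-padd []      q       z = sym (addᵛ-identityˡ (evalR q z))
evalR-padd (a ∷ p) []      z = sym (addᵛ-identityʳ (evalR (a ∷ p) z))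
evalR-padd (a ∷ p) (b ∷ q) z = begin
  addζ (const (a + b)) (mulR z (evalR (padd p q) z))
    ≡⟨ cong (λ w → addζ (const (a + b)) (mulR z w)) (evalR-padd p q z) ⟩
  addζ (const (a + b)) (mulR z (addζ (evalR p z) (evalR q z)))
    ≡⟨ solve 5 (λ A B Z P Q → (A :+ B) :+ Z :* (P :+ Q) := (A :+ Z :* P) :+ (B :+ Z :* Q))
             refl (const a) (const b) z (evalR p z) (evalR q z) ⟩
  addζ (evalR (a ∷ p) z) (evalR (b ∷ q) z) ∎

evalR-pscale : ∀ c p z → evalR (pscale c p) z ≡ scaleζ c (evalR p z)
evalR-pscale c []      z = sym (scaleᵛ-zeroʳ c)
evalR-pscale c (a ∷ p) z = begin
  addζ (const (c * a)) (mulR z (evalR (pscale c p) z))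
    ≡⟨ cong (λ w → addζ (const (c * a)) (mulR z w)) (evalR-pscale c p z) ⟩
  addζ (const (c * a)) (mulR z (scaleζ c (evalR p z)))
    ≡⟨ cong₂ addζ (cong (c * a ∷_) (sym (scaleᵛ-zeroʳ c))) (homogeneous (horner-isζLinear z) c (evalR p z)) ⟩
  addζ (scaleζ c (const a)) (scaleζ c (mulR z (evalR p z)))
    ≡⟨ sym (scaleᵛ-distribˡ c (const a) (mulR z (evalR p z))) ⟩
  scaleζ c (evalR (a ∷ p) z) ∎

evalR-pmul : ∀ p q z → evalR (pmul p q) z ≡ mulR (evalR p z) (evalR q z)
evalR-pmul []      q z = sym (mulR-by-zero {evalR [] z} refl (evalR q z))
evalR-pmul (a ∷ p) q z = begin
  evalR (padd (pscale a q) (+ 0 ∷ pmul p q)) z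
    ≡⟨ evalR-padd (pscale a q) (+ 0 ∷ pmul p q) z ⟩
  addζ (evalR (pscale a q) z) (addζ zeroζ (mulR z (evalR (pmul p q) z)))
    ≡⟨ cong₂ (λ s t → addζ s (addζ zeroζ (mulR z t)))
             (trans (evalR-pscale a q z) (sym (mulR-const a (evalR q z)))) (evalR-pmul p q z) ⟩
  addζ (mulR (const a) (evalR q z)) (addζ zeroζ (mulR z (mulR (evalR p z) (evalR q z))))
    ≡⟨ solve 4 (λ A Q Z P → A :* Q :+ (con (+ 0) :+ Z :* (P :* Q)) := (A :+ Z :* P) :* Q)
             refl (const a) (evalR q z) z (evalR p z) ⟩
  mulR (evalR (a ∷ p) z) (evalR q z) ∎

evalR-constant : ∀ c z → evalR (c ∷ []) z ≡ const c
evalR-constant c z = trans (cong (addζ (const c)) (mulR-zeroʳ z)) (addᵛ-identityʳ (const c))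

evalR-ppow : ∀ p n z → evalR (ppow p n) z ≡ powR (evalR p z) n
evalR-ppow p zero    z = evalR-constant (+ 1) z
evalR-ppow p (suc n) z = trans (evalR-pmul p (ppow p n) z) (cong (mulR (evalR p z)) (evalR-ppow p n z))

evalR-at-const : ∀ p c {w} → w ≡ const c → evalR p w ≡ const (evalℤ p c)
evalR-at-const []      c     w≡c = refl
evalR-at-const (a ∷ p) c {w} w≡c = begin
  addζ (const a) (mulR w (evalR p w))
    ≡⟨ cong (addζ (const a)) (mulR-by-const w≡c (evalR p w)) ⟩
  addζ (const a) (scaleζ c (evalR p w))
    ≡⟨ cong (λ y → addζ (const a) (scaleζ c y)) (evalR-at-const p c w≡c) ⟩
  addζ (const a) (scaleζ c (const (evalℤ p c)))
    ≡⟨ cong (λ v → a + c * evalℤ p c ∷ addᵛ zeroᵛ v) (scaleᵛ-zeroʳ c) ⟩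
  addζ (const a) (const (c * evalℤ p c)) ∎

evalR-at-root : ∀ Φ z → evalR Φ z ≡ zeroζ → ∀ A Q → evalR (padd A (pmul Φ Q)) z ≡ evalR A z
evalR-at-root Φ z Φ[z]≡0 A Q = begin
  evalR (padd A (pmul Φ Q)) z                      ≡⟨ evalR-padd A (pmul Φ Q) z ⟩
  addζ (evalR A z) (evalR (pmul Φ Q) z)            ≡⟨ cong (addζ (evalR A z)) (evalR-pmul Φ Q z) ⟩
  addζ (evalR A z) (mulR (evalR Φ z) (evalR Q z))  ≡⟨ cong (addζ (evalR A z)) (mulR-by-zero Φ[z]≡0 (evalR Q z)) ⟩
  addζ (evalR A z) zeroζ                           ≡⟨ addᵛ-identityʳ (evalR A z) ⟩
  evalR A z                                        ∎

isZeroPoly : Poly → Bool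
isZeroPoly []           = true
isZeroPoly (+ zero ∷ p) = isZeroPoly p
isZeroPoly (_      ∷ _) = false

evalR-isZeroPoly : ∀ p z → isZeroPoly p ≡ true → evalR p z ≡ zeroζ
evalR-isZeroPoly []           z _   = refl
evalR-isZeroPoly (+ zero ∷ p) z p≡0 = begin
  addζ zeroζ (mulR z (evalR p z))  ≡⟨ addᵛ-identityˡ (mulR z (evalR p z)) ⟩
  mulR z (evalR p z)               ≡⟨ cong (mulR z) (evalR-isZeroPoly p z p≡0) ⟩
  mulR z zeroζ                     ≡⟨ mulR-zeroʳ z ⟩
  zeroζ                            ∎

infix 4 _≃ₚ_

_≃ₚ_ : Poly → Poly → Set
p ≃ₚ q = isZeroPoly (padd p (pscale (- + 1) q)) ≡ true

evalR-≃ₚ : ∀ p q → p ≃ₚ q → ∀ z → evalR p z ≡ evalR q z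
evalR-≃ₚ p q p≃q z = begin
  evalR p z
    ≡⟨ solve 2 (λ P Q → P := (P :+ :- Q) :+ Q) refl (evalR p z) (evalR q z) ⟩
  addζ (addζ (evalR p z) (negζ (evalR q z))) (evalR q z)
    ≡⟨ cong (λ w → addζ w (evalR q z)) (sym (begin
         evalR (padd p (pscale (- + 1) q)) z
           ≡⟨ evalR-padd p (pscale (- + 1) q) z ⟩
         addζ (evalR p z) (evalR (pscale (- + 1) q) z)
           ≡⟨ cong (addζ (evalR p z)) (trans (evalR-pscale (- + 1) q z) (scaleζ-neg1 (evalR q z))) ⟩
         addζ (evalR p z) (negζ (evalR q z)) ∎)) ⟩
  addζ (evalR (padd p (pscale (- + 1) q)) z) (evalR q z)
    ≡⟨ cong (λ w → addζ w (evalR q z)) (evalR-isZeroPoly (padd p (pscale (- + 1) q)) z p≃q) ⟩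
  addζ zeroζ (evalR q z)
    ≡⟨ addᵛ-identityˡ (evalR q z) ⟩
  evalR q z ∎

xMinus1At : Zζ → Zζ
xMinus1At z = evalR xMinus1 z

oneMinusX : Poly
oneMinusX = pscale (- + 1) xMinus1

evalR-oneMinusX : ∀ z → evalR oneMinusX z ≡ negζ (xMinus1At z)
evalR-oneMinusX z = trans (evalR-pscale (- + 1) xMinus1 z) (scaleζ-neg1 (xMinus1At z))

evalR-G5 : ∀ h z → evalR (G5 h) z ≡ addζ oneζ (mulR (powR (xMinus1At z) 5) (evalR h z))
evalR-G5 h z = begin
  evalR (padd (+ 1 ∷ []) (pmul (ppow xMinus1 5) h)) z
    ≡⟨ evalR-padd (+ 1 ∷ []) (pmul (ppow xMinus1 5) h) z ⟩
  addζ (evalR (+ 1 ∷ []) z) (evalR (pmul (ppow xMinus1 5) h) z)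
    ≡⟨ cong₂ addζ (evalR-constant (+ 1) z) (evalR-pmul (ppow xMinus1 5) h z) ⟩
  addζ oneζ (mulR (evalR (ppow xMinus1 5) z) (evalR h z))
    ≡⟨ cong (λ w → addζ oneζ (mulR w (evalR h z))) (evalR-ppow xMinus1 5 z) ⟩
  addζ oneζ (mulR (powR (xMinus1At z) 5) (evalR h z)) ∎

-- The expansion of h around 1

taylorAt1 : ℤ → ℤ → ℤ → Poly
taylorAt1 a b c = padd (a ∷ []) (pmul xMinus1 (padd (b ∷ []) (pmul xMinus1 (c ∷ []))))

evalR-taylorAt1 : ∀ a b c z → evalR (taylorAt1 a b c) z ≡
                  addζ (const a) (mulR (xMinus1At z) (addζ (const b) (mulR (xMinus1At z) (const c))))
evalR-taylorAt1 a b c z = begin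
  evalR (padd (a ∷ []) (pmul xMinus1 q)) z
    ≡⟨ evalR-padd (a ∷ []) (pmul xMinus1 q) z ⟩
  addζ (evalR (a ∷ []) z) (evalR (pmul xMinus1 q) z)
    ≡⟨ cong₂ addζ (evalR-constant a z) (evalR-pmul xMinus1 q z) ⟩
  addζ (const a) (mulR (xMinus1At z) (evalR q z))
    ≡⟨ cong (λ w → addζ (const a) (mulR (xMinus1At z) w)) (evalR-padd (b ∷ []) (pmul xMinus1 (c ∷ [])) z) ⟩
  addζ (const a) (mulR (xMinus1At z) (addζ (evalR (b ∷ []) z) (evalR (pmul xMinus1 (c ∷ [])) z)))
    ≡⟨ cong₂ (λ v w → addζ (const a) (mulR (xMinus1At z) (addζ v w)))
             (evalR-constant b z)
             (trans (evalR-pmul xMinus1 (c ∷ []) z) (cong (mulR (xMinus1At z)) (evalR-constant c z))) ⟩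
  addζ (const a) (mulR (xMinus1At z) (addζ (const b) (mulR (xMinus1At z) (const c)))) ∎
  where
  q = padd (b ∷ []) (pmul xMinus1 (c ∷ []))

divideByXMinus1 : Poly → ℤ × Poly
divideByXMinus1 []      = + 0 , []
divideByXMinus1 (a ∷ p) = a + proj₁ (divideByXMinus1 p) , proj₁ (divideByXMinus1 p) ∷ proj₂ (divideByXMinus1 p)

divideByXMinus1-value : ∀ p → proj₁ (divideByXMinus1 p) ≡ evalℤ p (+ 1)
divideByXMinus1-value []      = refl
divideByXMinus1-value (a ∷ p) =
  cong (λ v → a + v) (trans (divideByXMinus1-value p) (sym (ℤ.*-identityˡ (evalℤ p (+ 1)))))

divideByXMinus1-evalR : ∀ p z → evalR p z ≡
  addζ (const (proj₁ (divideByXMinus1 p))) (mulR (xMinus1At z) (evalR (proj₂ (divideByXMinus1 p)) z))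
divideByXMinus1-evalR []      z = sym (trans (cong (addζ zeroζ) (mulR-zeroʳ (xMinus1At z))) (addᵛ-identityˡ zeroζ))
divideByXMinus1-evalR (a ∷ p) z = begin
  addζ (const a) (mulR z (evalR p z))
    ≡⟨ cong (λ w → addζ (const a) (mulR z w)) (divideByXMinus1-evalR p z) ⟩
  addζ (const a) (mulR z (addζ (const c) (mulR (xMinus1At z) (evalR q z))))
    ≡⟨ solve 4 (λ A C Z Q → let U = con (- + 1) :+ Z :* (con (+ 1) :+ Z :* con (+ 0)) in
                 A :+ Z :* (C :+ U :* Q) := (A :+ C) :+ U :* (C :+ Z :* Q))
             refl (const a) (const c) z (evalR q z) ⟩
  addζ (const (a + c)) (mulR (xMinus1At z) (evalR (c ∷ q) z)) ∎
  where
  c = proj₁ (divideByXMinus1 p)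
  q = proj₂ (divideByXMinus1 p)

digit : ℤ → Fin 3
digit c = fromℕ< (n%ℕd<d c 3)

digit-expansion : ∀ c → c ≡ + toℕ (digit c) + + 3 * (c /ℕ 3)
digit-expansion c = begin
  c                                 ≡⟨ a≡a%ℕn+[a/ℕn]*n c 3 ⟩
  + (c %ℕ 3) + c /ℕ 3 * + 3         ≡⟨ cong₂ (λ r s → + r + s) (sym (Fin.toℕ-fromℕ< (n%ℕd<d c 3)))
                                              (ℤ.*-comm (c /ℕ 3) (+ 3)) ⟩
  + toℕ (digit c) + + 3 * (c /ℕ 3)  ∎

scaleζ-nested : ∀ c A B D U → scaleζ c (addζ A (mulR U (addζ B (mulR U D)))) ≡
                addζ (scaleζ c A) (mulR U (addζ (scaleζ c B) (mulR U (scaleζ c D))))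
scaleζ-nested c A B D U = begin
  scaleζ c (addζ A (mulR U (addζ B (mulR U D))))
    ≡⟨ scaleᵛ-distribˡ c A (mulR U (addζ B (mulR U D))) ⟩
  addζ (scaleζ c A) (scaleζ c (mulR U (addζ B (mulR U D))))
    ≡⟨ cong (addζ (scaleζ c A)) (sym (homogeneous (horner-isζLinear U) c (addζ B (mulR U D)))) ⟩
  addζ (scaleζ c A) (mulR U (scaleζ c (addζ B (mulR U D))))
    ≡⟨ cong (λ w → addζ (scaleζ c A) (mulR U w)) (scaleᵛ-distribˡ c B (mulR U D)) ⟩
  addζ (scaleζ c A) (mulR U (addζ (scaleζ c B) (scaleζ c (mulR U D))))
    ≡⟨ cong (λ w → addζ (scaleζ c A) (mulR U (addζ (scaleζ c B) w))) (sym (homogeneous (horner-isζLinear U) c D)) ⟩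
  addζ (scaleζ c A) (mulR U (addζ (scaleζ c B) (mulR U (scaleζ c D)))) ∎

regroup-digits : ∀ U τ R₀ R₁ R₂ S₀ S₁ S₂ →
  addζ (addζ R₀ S₀) (mulR U (addζ (addζ R₁ S₁) (mulR U (addζ (addζ R₂ S₂) (mulR U τ))))) ≡
  addζ (addζ R₀ (mulR U (addζ R₁ (mulR U R₂)))) (addζ (addζ S₀ (mulR U (addζ S₁ (mulR U S₂)))) (mulR (powR U 3) τ))
regroup-digits = solve 8 (λ U τ R₀ R₁ R₂ S₀ S₁ S₂ →
  (R₀ :+ S₀) :+ U :* ((R₁ :+ S₁) :+ U :* ((R₂ :+ S₂) :+ U :* τ)) :=
  (R₀ :+ U :* (R₁ :+ U :* R₂)) :+ ((S₀ :+ U :* (S₁ :+ U :* S₂)) :+ (U :^ 3) :* τ)) refl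

record Splitting (h : Poly) : Set where
  field
    r₀ r₁ r₂ : Fin 3
    σ t      : Poly
    evalR-h  : ∀ z → evalR h z ≡ addζ (evalR (taylorAt1 (+ toℕ r₀) (+ toℕ r₁) (+ toℕ r₂)) z)
                                       (addζ (scaleζ (+ 3) (evalR σ z)) (mulR (powR (xMinus1At z) 3) (evalR t z)))
    3∣h[1]   : r₀ ≡ 0F → + 3 ∣ evalℤ h (+ 1)

splitting : ∀ h → Splitting h
splitting h = record
  { r₀ = digit c₀ ; r₁ = digit c₁ ; r₂ = digit c₂
  ; σ = taylorAt1 (c₀ /ℕ 3) (c₁ /ℕ 3) (c₂ /ℕ 3)
  ; t = t
  ; evalR-h = evalR-h
  ; 3∣h[1] = 3∣h[1]
  }
  where
  c₀ = proj₁ (divideByXMinus1 h)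
  q₀ = proj₂ (divideByXMinus1 h)
  c₁ = proj₁ (divideByXMinus1 q₀)
  q₁ = proj₂ (divideByXMinus1 q₀)
  c₂ = proj₁ (divideByXMinus1 q₁)
  t  = proj₂ (divideByXMinus1 q₁)

  evalR-h : ∀ z → evalR h z ≡ addζ (evalR (taylorAt1 (+ toℕ (digit c₀)) (+ toℕ (digit c₁)) (+ toℕ (digit c₂))) z)
                                   (addζ (scaleζ (+ 3) (evalR (taylorAt1 (c₀ /ℕ 3) (c₁ /ℕ 3) (c₂ /ℕ 3)) z))
                                         (mulR (powR (xMinus1At z) 3) (evalR t z)))
  evalR-h z = begin
    evalR h z
      ≡⟨ divideByXMinus1-evalR h z ⟩
    addζ (const c₀) (mulR U (evalR q₀ z))
      ≡⟨ cong (λ w → addζ (const c₀) (mulR U w)) (divideByXMinus1-evalR q₀ z) ⟩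
    addζ (const c₀) (mulR U (addζ (const c₁) (mulR U (evalR q₁ z))))
      ≡⟨ cong (λ w → addζ (const c₀) (mulR U (addζ (const c₁) (mulR U w)))) (divideByXMinus1-evalR q₁ z) ⟩
    addζ (const c₀) (mulR U (addζ (const c₁) (mulR U (addζ (const c₂) (mulR U t[z])))))
      ≡⟨ cong₂ (λ a bc → addζ (const a) (mulR U (addζ (const (proj₁ bc)) (mulR U (addζ (const (proj₂ bc)) (mulR U t[z]))))))
               (digit-expansion c₀) (cong₂ _,_ (digit-expansion c₁) (digit-expansion c₂)) ⟩
    addζ (addζ (const r₀) (scaleζ (+ 3) (const s₀)))
         (mulR U (addζ (addζ (const r₁) (scaleζ (+ 3) (const s₁)))
                       (mulR U (addζ (addζ (const r₂) (scaleζ (+ 3) (const s₂))) (mulR U t[z])))))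
      ≡⟨ regroup-digits U t[z] (const r₀) (const r₁) (const r₂)
                        (scaleζ (+ 3) (const s₀)) (scaleζ (+ 3) (const s₁)) (scaleζ (+ 3) (const s₂)) ⟩
    addζ (addζ (const r₀) (mulR U (addζ (const r₁) (mulR U (const r₂)))))
         (addζ (addζ (scaleζ (+ 3) (const s₀)) (mulR U (addζ (scaleζ (+ 3) (const s₁)) (mulR U (scaleζ (+ 3) (const s₂))))))
               (mulR (powR U 3) t[z]))
      ≡⟨ cong₂ (λ a b → addζ a (addζ b (mulR (powR U 3) t[z])))
               (sym (evalR-taylorAt1 r₀ r₁ r₂ z))
               (trans (sym (scaleζ-nested (+ 3) (const s₀) (const s₁) (const s₂) U))
                      (cong (scaleζ (+ 3)) (sym (evalR-taylorAt1 s₀ s₁ s₂ z)))) ⟩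
    addζ (evalR (taylorAt1 r₀ r₁ r₂) z) (addζ (scaleζ (+ 3) (evalR (taylorAt1 s₀ s₁ s₂) z)) (mulR (powR U 3) t[z])) ∎
    where
    U = xMinus1At z
    t[z] = evalR t z
    r₀ = + toℕ (digit c₀)
    r₁ = + toℕ (digit c₁)
    r₂ = + toℕ (digit c₂)
    s₀ = c₀ /ℕ 3
    s₁ = c₁ /ℕ 3
    s₂ = c₂ /ℕ 3

  3∣h[1] : digit c₀ ≡ 0F → + 3 ∣ evalℤ h (+ 1)
  3∣h[1] r₀≡0 = Signed.∣⇒∣ᵤ (Signed.divides (c₀ /ℕ 3) (begin
    evalℤ h (+ 1)                       ≡⟨ sym (divideByXMinus1-value h) ⟩
    c₀                                  ≡⟨ digit-expansion c₀ ⟩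
    + toℕ (digit c₀) + + 3 * (c₀ /ℕ 3)  ≡⟨ cong (λ r → + toℕ r + + 3 * (c₀ /ℕ 3)) r₀≡0 ⟩
    + 0 + + 3 * (c₀ /ℕ 3)               ≡⟨ ℤ.+-identityˡ (+ 3 * (c₀ /ℕ 3)) ⟩
    + 3 * (c₀ /ℕ 3)                     ≡⟨ ℤ.*-comm (+ 3) (c₀ /ℕ 3) ⟩
    c₀ /ℕ 3 * + 3                       ∎))

unitζ : ℕ → Zζ
unitζ k = Vec.tabulate (λ i → if toℕ i ℕ.≡ᵇ k then + 1 else + 0)

-- ζᵏ for k < 27: the k-th unit vector for k < 18, and ζ¹⁸⁺ⁱ = −ζⁱ − ζ⁹⁺ⁱ because ζ¹⁸ = −ζ⁹ − 1.
ζ-power-table : ℕ → Zζ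
ζ-power-table k = if k ℕ.<ᵇ 18 then unitζ k else negζ (addζ (unitζ (k ℕ.∸ 18)) (unitζ (k ℕ.∸ 9)))

_≟ζ_ : DecidableEquality Zζ
_≟ζ_ = Vec.≡-dec ℤ._≟_

ζ-power-table-step : ∀ (k : Fin 27) → mulζ (ζ-power-table (toℕ k)) ≡ ζ-power-table (suc (toℕ k) % 27)
ζ-power-table-step =
  from-yes (Fin.all? (λ (k : Fin 27) → mulζ (ζ-power-table (toℕ k)) ≟ζ ζ-power-table (suc (toℕ k) % 27)))

ζ^ : ℕ → Zζ
ζ^ n = ζ-power-table (n % 27)

ζ^≡powR : ∀ n → ζ^ n ≡ powR ζ n
ζ^≡powR zero    = refl
ζ^≡powR (suc n) = begin
  ζ-power-table (suc n % 27)         ≡⟨ cong ζ-power-table (%-distribˡ-+ 1 n 27) ⟩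
  ζ-power-table (suc (n % 27) % 27)  ≡⟨ cong (λ i → ζ-power-table (suc i % 27)) (sym k≡n%27) ⟩
  ζ-power-table (suc (toℕ k) % 27)   ≡⟨ sym (ζ-power-table-step k) ⟩
  mulζ (ζ-power-table (toℕ k))       ≡⟨ cong (mulζ ∘ ζ-power-table) k≡n%27 ⟩
  mulζ (ζ^ n)                        ≡⟨ cong mulζ (ζ^≡powR n) ⟩
  mulζ (powR ζ n)                    ≡⟨ sym (mulR-ζ (powR ζ n)) ⟩
  mulR ζ (powR ζ n)                  ≡⟨ sym (powR-suc ζ n) ⟩
  powR ζ (suc n)                     ∎
  where
  k : Fin 27
  k = fromℕ< (m%n<n n 27)
  k≡n%27 : toℕ k ≡ n % 27
  k≡n%27 = Fin.toℕ-fromℕ< (m%n<n n 27)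

ζ^-times-evalAtζ^ : Poly → ℕ → ℕ → Zζ
ζ^-times-evalAtζ^ []      j k = zeroζ
ζ^-times-evalAtζ^ (c ∷ p) j k = addζ (scaleζ c (ζ^ k)) (ζ^-times-evalAtζ^ p j (k ℕ.+ j))

evalAtζ^ : Poly → ℕ → Zζ
evalAtζ^ p j = ζ^-times-evalAtζ^ p j 0

ζ^-times-evalAtζ^-correct : ∀ p j k → ζ^-times-evalAtζ^ p j k ≡ mulR (powR ζ k) (evalR p (powR ζ j))
ζ^-times-evalAtζ^-correct []      j k = sym (mulR-zeroʳ (powR ζ k))
ζ^-times-evalAtζ^-correct (c ∷ p) j k = begin
  addζ (scaleζ c (ζ^ k)) (ζ^-times-evalAtζ^ p j (k ℕ.+ j))
    ≡⟨ cong₂ addζ (trans (cong (scaleζ c) (ζ^≡powR k)) (sym (mulR-const c (powR ζ k))))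
                  (trans (ζ^-times-evalAtζ^-correct p j (k ℕ.+ j)) (cong (λ w → mulR w p[ζʲ]) (powR-+ ζ k j))) ⟩
  addζ (mulR (const c) (powR ζ k)) (mulR (mulR (powR ζ k) (powR ζ j)) p[ζʲ])
    ≡⟨ solve 4 (λ C K J P → C :* K :+ (K :* J) :* P := K :* (C :+ J :* P)) refl (const c) (powR ζ k) (powR ζ j) p[ζʲ] ⟩
  mulR (powR ζ k) (evalR (c ∷ p) (powR ζ j)) ∎
  where
  p[ζʲ] = evalR p (powR ζ j)

evalAtζ^-correct : ∀ p j → evalAtζ^ p j ≡ evalR p (powR ζ j)
evalAtζ^-correct p j = trans (ζ^-times-evalAtζ^-correct p j 0) (mulR-identityˡ (evalR p (powR ζ j)))

forceℤ : ℤ → (ℤ → A) → A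
forceℤ (+ n)    k = force n (λ n′ → k (+ n′))
forceℤ -[1+ n ] k = force n (λ n′ → k -[1+ n′ ])

forceℤ-≡ : ∀ x (k : ℤ → A) → forceℤ x k ≡ k x
forceℤ-≡ (+ n)    k = force-≡ n (λ n′ → k (+ n′))
forceℤ-≡ -[1+ n ] k = force-≡ n (λ n′ → k -[1+ n′ ])

forceᵛ : Vec ℤ n → (Vec ℤ n → A) → A
forceᵛ []       k = k []
forceᵛ (x ∷ xs) k = forceℤ x (λ x′ → forceᵛ xs (λ xs′ → k (x′ ∷ xs′)))

forceᵛ-≡ : ∀ (v : Vec ℤ n) (k : Vec ℤ n → A) → forceᵛ v k ≡ k v
forceᵛ-≡ []       k = refl
forceᵛ-≡ (x ∷ xs) k = trans (forceℤ-≡ x _) (forceᵛ-≡ xs (λ xs′ → k (x ∷ xs′)))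

-- Agda's conversion checker reduces a vector one component at a time, redoing the shared work for
-- each component; `strictly v` computes all components of v in a single evaluation, which is what
-- makes the numerical identities below checkable by refl.
strictly : Zζ → Zζ
strictly v = forceᵛ v id

strictly-≡ : ∀ v → strictly v ≡ v
strictly-≡ v = forceᵛ-≡ v id

-- Norms

rootIndices : ℕ → List ℕ
rootIndices k = List.filterᵇ (λ j → not (j % 3 ℕ.≡ᵇ 0)) (List.map suc (List.upTo (3 ℕ.^ k)))

rootExponent : ℕ → ℕ → ℕ
rootExponent k j = 3 ℕ.^ (3 ℕ.∸ k) ℕ.* j

OnRoots : ℕ → (Zζ → Set) → Set
OnRoots k P = All (λ j → P (powR ζ (rootExponent k j))) (rootIndices k)

N-cong : ∀ k F G → OnRoots k (λ z → evalR F z ≡ evalR G z) → N k F ≡ N k G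
N-cong k F G F≡G = cong prodR (List.map-cong-local F≡G)

prodR-map-mulR : ∀ (f g : A → Zζ) xs →
                 prodR (List.map (λ x → mulR (f x) (g x)) xs) ≡ mulR (prodR (List.map f xs)) (prodR (List.map g xs))
prodR-map-mulR f g []       = sym (mulR-identityˡ oneζ)
prodR-map-mulR f g (x ∷ xs) = begin
  mulR (mulR (f x) (g x)) (prodR (List.map (λ x → mulR (f x) (g x)) xs))
    ≡⟨ cong (mulR (mulR (f x) (g x))) (prodR-map-mulR f g xs) ⟩
  mulR (mulR (f x) (g x)) (mulR (prodR (List.map f xs)) (prodR (List.map g xs)))
    ≡⟨ solve 4 (λ a b c d → (a :* b) :* (c :* d) := (a :* c) :* (b :* d)) refl
             (f x) (g x) (prodR (List.map f xs)) (prodR (List.map g xs)) ⟩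
  mulR (mulR (f x) (prodR (List.map f xs))) (mulR (g x) (prodR (List.map g xs))) ∎

N-mulR : ∀ k F G H → OnRoots k (λ z → evalR F z ≡ mulR (evalR G z) (evalR H z)) → N k F ≡ mulR (N k G) (N k H)
N-mulR k F G H F≡GH = trans (cong prodR (List.map-cong-local F≡GH))
  (prodR-map-mulR (λ j → evalR G (powR ζ (rootExponent k j))) (λ j → evalR H (powR ζ (rootExponent k j))) (rootIndices k))

VanishesOnRoots : ℕ → Poly → Set
VanishesOnRoots k G = All (λ j → evalAtζ^ G (rootExponent k j) ≡ zeroζ) (rootIndices k)

vanishes? : ∀ k G → Dec (VanishesOnRoots k G)
vanishes? k G = All.all? (λ j → evalAtζ^ G (rootExponent k j) ≟ζ zeroζ) (rootIndices k)

vanishes-by-evaluation : ∀ k G → VanishesOnRoots k G → OnRoots k (λ z → evalR G z ≡ zeroζ)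
vanishes-by-evaluation k G = All.map (λ {j} G≡0 → trans (sym (evalAtζ^-correct G (rootExponent k j))) G≡0)

fastN : ℕ → Poly → Zζ
fastN k G = prodR (List.map (λ j → evalAtζ^ G (rootExponent k j)) (rootIndices k))

N-by-evaluation : ∀ k G {c} → strictly (fastN k G) ≡ c → N k G ≡ c
N-by-evaluation k G {c} fastN≡c = begin
  N k G                 ≡⟨ cong prodR (List.map-cong (λ j → sym (evalAtζ^-correct G (rootExponent k j))) (rootIndices k)) ⟩
  fastN k G             ≡⟨ sym (strictly-≡ (fastN k G)) ⟩
  strictly (fastN k G)  ≡⟨ fastN≡c ⟩
  c                     ∎

prodR-++ : ∀ xs ys → prodR (xs ++ ys) ≡ mulR (prodR xs) (prodR ys)
prodR-++ []       ys = sym (mulR-identityˡ (prodR ys))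
prodR-++ (x ∷ xs) ys = trans (cong (mulR x) (prodR-++ xs ys)) (sym (mulR-assoc x (prodR xs) (prodR ys)))

prodR-map-++ : ∀ (f : A → Zζ) xs ys → prodR (List.map f (xs ++ ys)) ≡ mulR (prodR (List.map f xs)) (prodR (List.map f ys))
prodR-map-++ f xs ys = trans (cong prodR (List.map-++ f xs ys)) (prodR-++ (List.map f xs) (List.map f ys))

prodR-↭ : ∀ {xs ys} → xs ↭ ys → prodR xs ≡ prodR ys
prodR-↭ xs↭ys = foldr-commMonoid (CommutativeRing.*-isCommutativeMonoid Zζ-commutativeRing) (↭⇒↭ₛ xs↭ys)

↭-by-sorting : ∀ {xs ys : List ℕ} → sort xs ≡ sort ys → xs ↭ ys
↭-by-sorting {xs} {ys} same = ↭-trans (↭-sym (sort-↭ xs)) (subst (_↭ ys) (sym same) (sort-↭ ys))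

rootExponents : ℕ → List ℕ
rootExponents k = List.map (rootExponent k) (rootIndices k)

levelProduct : (ℕ → Zζ) → ℕ → Zζ
levelProduct f k = prodR (List.map f (rootExponents k))

N-as-levelProduct : ∀ k G → N k G ≡ levelProduct (λ j → evalR G (powR ζ j)) k
N-as-levelProduct k G = cong prodR (List.map-∘ (rootIndices k))

RootPartition : ℕ → ℕ → Set
RootPartition a b = List.upTo 27 ↭ 0 ∷ rootExponents 1 ++ rootExponents a ++ rootExponents b

prodR-upTo27-split : ∀ a b → RootPartition a b → ∀ (f : ℕ → Zζ) →
  prodR (List.map f (List.upTo 27)) ≡ mulR (f 0) (mulR (levelProduct f 1) (mulR (levelProduct f a) (levelProduct f b)))
prodR-upTo27-split a b partition f = begin
  prodR (List.map f (List.upTo 27))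
    ≡⟨ prodR-↭ (map⁺ f partition) ⟩
  mulR (f 0) (prodR (List.map f (rootExponents 1 ++ rootExponents a ++ rootExponents b)))
    ≡⟨ cong (mulR (f 0)) (prodR-map-++ f (rootExponents 1) (rootExponents a ++ rootExponents b)) ⟩
  mulR (f 0) (mulR (levelProduct f 1) (prodR (List.map f (rootExponents a ++ rootExponents b))))
    ≡⟨ cong (λ w → mulR (f 0) (mulR (levelProduct f 1) w)) (prodR-map-++ f (rootExponents a) (rootExponents b)) ⟩
  mulR (f 0) (mulR (levelProduct f 1) (mulR (levelProduct f a) (levelProduct f b))) ∎

M27-split : ∀ a b → RootPartition a b → ∀ G → M27 G ≡ mulR (evalR G oneζ) (mulR (N 1 G) (mulR (N a G) (N b G)))
M27-split a b partition G = trans (prodR-upTo27-split a b partition (λ j → evalR G (powR ζ j)))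
  (sym (cong₂ (λ x y → mulR (evalR G oneζ) (mulR x y))
              (N-as-levelProduct 1 G) (cong₂ mulR (N-as-levelProduct a G) (N-as-levelProduct b G))))

-- The construction

glue-identity : ∀ E U R S τ →
  addζ (mulR (mulR (negζ U) E) (addζ oneζ (mulR (powR U 5) R)))
       (mulR E (addζ (mulR S (mulR (mulR (const (+ 3)) (negζ U)) (powR U 5))) (mulR τ (mulR (negζ U) (powR U 8))))) ≡
  mulR (mulR (negζ U) E) (addζ oneζ (mulR (powR U 5) (addζ R (addζ (mulR (const (+ 3)) S) (mulR (powR U 3) τ)))))
glue-identity = solve 5 (λ E U R S τ →
  ((:- U) :* E) :* (con (+ 1) :+ (U :^ 5) :* R)
    :+ E :* (S :* ((con (+ 3) :* (:- U)) :* (U :^ 5)) :+ τ :* ((:- U) :* (U :^ 8))) :=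
  ((:- U) :* E) :* (con (+ 1) :+ (U :^ 5) :* (R :+ (con (+ 3) :* S :+ (U :^ 3) :* τ)))) refl

3⁴*m≡81*m : ∀ m → + 3 * (+ 3 * (+ 3 * (+ 3 * m))) ≡ + 81 * m
3⁴*m≡81*m m = begin
  + 3 * (+ 3 * (+ 3 * (+ 3 * m)))  ≡⟨ sym (ℤ.*-assoc (+ 3) (+ 3) (+ 3 * (+ 3 * m))) ⟩
  + 9 * (+ 3 * (+ 3 * m))          ≡⟨ sym (ℤ.*-assoc (+ 9) (+ 3) (+ 3 * m)) ⟩
  + 27 * (+ 3 * m)                 ≡⟨ sym (ℤ.*-assoc (+ 27) (+ 3) m) ⟩
  + 81 * m                         ∎

record Level (k k′ : ℕ) : Set where
  field
    Φ T Eₛ Eₜ Qₛ Qₜ : Poly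
    Eₛ-congruence : pmul T Eₛ ≃ₚ padd (pmul (pscale (+ 3) oneMinusX) (ppow xMinus1 5)) (pmul Φ Qₛ)
    Eₜ-congruence : pmul T Eₜ ≃ₚ padd (pmul oneMinusX (ppow xMinus1 8)) (pmul Φ Qₜ)
    T[1]≡0        : evalℤ T (+ 1) ≡ + 0
    Φ-vanishes    : VanishesOnRoots k Φ
    T-vanishes₁   : VanishesOnRoots 1 T
    T-vanishes′   : VanishesOnRoots k′ T
    partition     : RootPartition k′ k

module Gluing {k k′ : ℕ} (L : Level k k′) where
  open Level L

  seed : (ρ ε Q : Poly) → Poly
  seed ρ ε Q = padd (pmul (pmul oneMinusX ε) (G5 ρ)) (pmul Φ Q)

  glue : (ρ ε Q σ t : Poly) → Poly
  glue ρ ε Q σ t = padd (seed ρ ε Q) (pmul ε (padd (pmul σ (pmul T Eₛ)) (pmul t (pmul T Eₜ))))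

  evalR-glue : ∀ ρ ε Q σ t z → evalR (glue ρ ε Q σ t) z ≡
    addζ (evalR (seed ρ ε Q) z)
         (mulR (evalR ε z) (addζ (mulR (evalR σ z) (mulR (evalR T z) (evalR Eₛ z)))
                                 (mulR (evalR t z) (mulR (evalR T z) (evalR Eₜ z)))))
  evalR-glue ρ ε Q σ t z = begin
    evalR (padd (seed ρ ε Q) (pmul ε D)) z
      ≡⟨ evalR-padd (seed ρ ε Q) (pmul ε D) z ⟩
    addζ (evalR (seed ρ ε Q) z) (evalR (pmul ε D) z)
      ≡⟨ cong (addζ (evalR (seed ρ ε Q) z)) (evalR-pmul ε D z) ⟩
    addζ (evalR (seed ρ ε Q) z) (mulR (evalR ε z) (evalR D z))
      ≡⟨ cong (λ w → addζ (evalR (seed ρ ε Q) z) (mulR (evalR ε z) w))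
              (evalR-padd (pmul σ (pmul T Eₛ)) (pmul t (pmul T Eₜ)) z) ⟩
    addζ (evalR (seed ρ ε Q) z) (mulR (evalR ε z) (addζ (evalR (pmul σ (pmul T Eₛ)) z) (evalR (pmul t (pmul T Eₜ)) z)))
      ≡⟨ cong₂ (λ a b → addζ (evalR (seed ρ ε Q) z) (mulR (evalR ε z) (addζ a b)))
               (trans (evalR-pmul σ (pmul T Eₛ) z) (cong (mulR (evalR σ z)) (evalR-pmul T Eₛ z)))
               (trans (evalR-pmul t (pmul T Eₜ) z) (cong (mulR (evalR t z)) (evalR-pmul T Eₜ z))) ⟩
    addζ (evalR (seed ρ ε Q) z)
         (mulR (evalR ε z) (addζ (mulR (evalR σ z) (mulR (evalR T z) (evalR Eₛ z)))
                                 (mulR (evalR t z) (mulR (evalR T z) (evalR Eₜ z))))) ∎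
    where
    D = padd (pmul σ (pmul T Eₛ)) (pmul t (pmul T Eₜ))

  glue-at-T-root : ∀ ρ ε Q σ t {z} → evalR T z ≡ zeroζ → evalR (glue ρ ε Q σ t) z ≡ evalR (seed ρ ε Q) z
  glue-at-T-root ρ ε Q σ t {z} T[z]≡0 = begin
    evalR (glue ρ ε Q σ t) z
      ≡⟨ evalR-glue ρ ε Q σ t z ⟩
    addζ seed[z] (mulR ε[z] (addζ (mulR σ[z] (mulR (evalR T z) Eₛ[z])) (mulR t[z] (mulR (evalR T z) Eₜ[z]))))
      ≡⟨ cong₂ (λ a b → addζ seed[z] (mulR ε[z] (addζ (mulR σ[z] a) (mulR t[z] b))))
               (mulR-by-zero T[z]≡0 Eₛ[z]) (mulR-by-zero T[z]≡0 Eₜ[z]) ⟩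
    addζ seed[z] (mulR ε[z] (addζ (mulR σ[z] zeroζ) (mulR t[z] zeroζ)))
      ≡⟨ cong₂ (λ a b → addζ seed[z] (mulR ε[z] (addζ a b))) (mulR-zeroʳ σ[z]) (mulR-zeroʳ t[z]) ⟩
    addζ seed[z] (mulR ε[z] zeroζ)
      ≡⟨ cong (addζ seed[z]) (mulR-zeroʳ ε[z]) ⟩
    addζ seed[z] zeroζ
      ≡⟨ addᵛ-identityʳ seed[z] ⟩
    seed[z] ∎
    where
    seed[z] = evalR (seed ρ ε Q) z
    ε[z] = evalR ε z
    σ[z] = evalR σ z
    t[z] = evalR t z
    Eₛ[z] = evalR Eₛ z
    Eₜ[z] = evalR Eₜ z

  module _ {z : Zζ} (Φ[z]≡0 : evalR Φ z ≡ zeroζ) where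

    private
      U = xMinus1At z

    TEₛ-at-Φ-root : mulR (evalR T z) (evalR Eₛ z) ≡ mulR (mulR (const (+ 3)) (negζ U)) (powR U 5)
    TEₛ-at-Φ-root = begin
      mulR (evalR T z) (evalR Eₛ z)
        ≡⟨ sym (evalR-pmul T Eₛ z) ⟩
      evalR (pmul T Eₛ) z
        ≡⟨ evalR-≃ₚ (pmul T Eₛ) (padd Rₛ (pmul Φ Qₛ)) Eₛ-congruence z ⟩
      evalR (padd Rₛ (pmul Φ Qₛ)) z
        ≡⟨ evalR-at-root Φ z Φ[z]≡0 Rₛ Qₛ ⟩
      evalR (pmul (pscale (+ 3) oneMinusX) (ppow xMinus1 5)) z
        ≡⟨ evalR-pmul (pscale (+ 3) oneMinusX) (ppow xMinus1 5) z ⟩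
      mulR (evalR (pscale (+ 3) oneMinusX) z) (evalR (ppow xMinus1 5) z)
        ≡⟨ cong₂ mulR (trans (evalR-pscale (+ 3) oneMinusX z)
                             (trans (cong (scaleζ (+ 3)) (evalR-oneMinusX z)) (sym (mulR-const (+ 3) (negζ U)))))
                      (evalR-ppow xMinus1 5 z) ⟩
      mulR (mulR (const (+ 3)) (negζ U)) (powR U 5) ∎
      where
      Rₛ = pmul (pscale (+ 3) oneMinusX) (ppow xMinus1 5)

    TEₜ-at-Φ-root : mulR (evalR T z) (evalR Eₜ z) ≡ mulR (negζ U) (powR U 8)
    TEₜ-at-Φ-root = begin
      mulR (evalR T z) (evalR Eₜ z)
        ≡⟨ sym (evalR-pmul T Eₜ z) ⟩
      evalR (pmul T Eₜ) z
        ≡⟨ evalR-≃ₚ (pmul T Eₜ) (padd Rₜ (pmul Φ Qₜ)) Eₜ-congruence z ⟩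
      evalR (padd Rₜ (pmul Φ Qₜ)) z
        ≡⟨ evalR-at-root Φ z Φ[z]≡0 Rₜ Qₜ ⟩
      evalR (pmul oneMinusX (ppow xMinus1 8)) z
        ≡⟨ evalR-pmul oneMinusX (ppow xMinus1 8) z ⟩
      mulR (evalR oneMinusX z) (evalR (ppow xMinus1 8) z)
        ≡⟨ cong₂ mulR (evalR-oneMinusX z) (evalR-ppow xMinus1 8 z) ⟩
      mulR (negζ U) (powR U 8) ∎
      where
      Rₜ = pmul oneMinusX (ppow xMinus1 8)

    evalR-factor : ∀ ε → evalR (pmul oneMinusX ε) z ≡ mulR (negζ U) (evalR ε z)
    evalR-factor ε = trans (evalR-pmul oneMinusX ε z) (cong (λ w → mulR w (evalR ε z)) (evalR-oneMinusX z))

    seed-at-Φ-root : ∀ ρ ε Q →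
      evalR (seed ρ ε Q) z ≡ mulR (mulR (negζ U) (evalR ε z)) (addζ oneζ (mulR (powR U 5) (evalR ρ z)))
    seed-at-Φ-root ρ ε Q = begin
      evalR (seed ρ ε Q) z
        ≡⟨ evalR-at-root Φ z Φ[z]≡0 (pmul (pmul oneMinusX ε) (G5 ρ)) Q ⟩
      evalR (pmul (pmul oneMinusX ε) (G5 ρ)) z
        ≡⟨ evalR-pmul (pmul oneMinusX ε) (G5 ρ) z ⟩
      mulR (evalR (pmul oneMinusX ε) z) (evalR (G5 ρ) z)
        ≡⟨ cong₂ mulR (evalR-factor ε) (evalR-G5 ρ z) ⟩
      mulR (mulR (negζ U) (evalR ε z)) (addζ oneζ (mulR (powR U 5) (evalR ρ z))) ∎

    glue-at-Φ-root : ∀ ρ ε Q σ t h →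
      evalR h z ≡ addζ (evalR ρ z) (addζ (scaleζ (+ 3) (evalR σ z)) (mulR (powR U 3) (evalR t z))) →
      evalR (glue ρ ε Q σ t) z ≡ mulR (evalR (pmul oneMinusX ε) z) (evalR (G5 h) z)
    glue-at-Φ-root ρ ε Q σ t h h[z]≡ = begin
      evalR (glue ρ ε Q σ t) z
        ≡⟨ evalR-glue ρ ε Q σ t z ⟩
      addζ (evalR (seed ρ ε Q) z)
           (mulR ε[z] (addζ (mulR σ[z] (mulR (evalR T z) (evalR Eₛ z))) (mulR t[z] (mulR (evalR T z) (evalR Eₜ z)))))
        ≡⟨ cong₂ (λ a b → addζ a (mulR ε[z] b)) (seed-at-Φ-root ρ ε Q)
                 (cong₂ (λ a b → addζ (mulR σ[z] a) (mulR t[z] b)) TEₛ-at-Φ-root TEₜ-at-Φ-root) ⟩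
      addζ (mulR (mulR (negζ U) ε[z]) (addζ oneζ (mulR (powR U 5) ρ[z])))
           (mulR ε[z] (addζ (mulR σ[z] (mulR (mulR (const (+ 3)) (negζ U)) (powR U 5)))
                            (mulR t[z] (mulR (negζ U) (powR U 8)))))
        ≡⟨ glue-identity ε[z] U ρ[z] σ[z] t[z] ⟩
      mulR (mulR (negζ U) ε[z]) (addζ oneζ (mulR (powR U 5) (addζ ρ[z] (addζ (mulR (const (+ 3)) σ[z]) (mulR (powR U 3) t[z])))))
        ≡⟨ cong₂ (λ a b → mulR a (addζ oneζ (mulR (powR U 5) b)))
                 (sym (evalR-factor ε))
                 (sym (trans h[z]≡ (cong (λ w → addζ ρ[z] (addζ w (mulR (powR U 3) t[z]))) (sym (mulR-const (+ 3) σ[z]))))) ⟩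
      mulR (evalR (pmul oneMinusX ε) z) (addζ oneζ (mulR (powR U 5) (evalR h z)))
        ≡⟨ cong (mulR (evalR (pmul oneMinusX ε) z)) (sym (evalR-G5 h z)) ⟩
      mulR (evalR (pmul oneMinusX ε) z) (evalR (G5 h) z) ∎
      where
      ε[z] = evalR ε z
      ρ[z] = evalR ρ z
      σ[z] = evalR σ z
      t[z] = evalR t z

  record Certificate (ρ : Poly) : Set where
    constructor certificate
    field
      ε Q       : Poly
      seed[1]≡3 : evalℤ (seed ρ ε Q) (+ 1) ≡ + 3
      N₁-seed   : strictly (fastN 1 (seed ρ ε Q)) ≡ const (+ 3)
      N′-seed   : strictly (fastN k′ (seed ρ ε Q)) ≡ const (+ 3)
      Nₖ-factor : strictly (fastN k (pmul oneMinusX ε)) ≡ const (+ 3)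

  Certificates : Set
  Certificates = ∀ (r₀ r₁ r₂ : Fin 3) → r₀ ≢ 0F → Certificate (taylorAt1 (+ toℕ r₀) (+ toℕ r₁) (+ toℕ r₂))

  realise : Certificates → ∀ m →
    (Σ Poly λ h → ¬ (+ 3 ∣ evalℤ h (+ 1)) × const m ≡ N k (G5 h)) →
    Σ Poly λ F → evalℤ F (+ 1) ≡ + 3 × N 1 F ≡ const (+ 3) × N k′ F ≡ const (+ 3)
      × N k F ≡ const (+ 3 * m) × M27 F ≡ const (+ 81 * m)
  realise certificates m (h , 3∤h[1] , m≡Nₖ) = F , F[1]≡3 , N₁-F , N′-F , Nₖ-F , M27-F
    where
    open Splitting (splitting h)
    open Certificate (certificates r₀ r₁ r₂ (λ r₀≡0 → 3∤h[1] (3∣h[1] r₀≡0)))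

    ρ = taylorAt1 (+ toℕ r₀) (+ toℕ r₁) (+ toℕ r₂)
    F = glue ρ ε Q σ t

    agrees-with-seed : ∀ j → VanishesOnRoots j T → OnRoots j (λ z → evalR F z ≡ evalR (seed ρ ε Q) z)
    agrees-with-seed j T≡0 =
      All.map (λ {i} → glue-at-T-root ρ ε Q σ t {powR ζ (rootExponent j i)}) (vanishes-by-evaluation j T T≡0)

    F[1]≡3 : evalℤ F (+ 1) ≡ + 3
    F[1]≡3 = const-injective (begin
      const (evalℤ F (+ 1))             ≡⟨ sym (evalR-at-const F (+ 1) refl) ⟩
      evalR F oneζ                      ≡⟨ glue-at-T-root ρ ε Q σ t {oneζ}
                                             (trans (evalR-at-const T (+ 1) refl) (cong const T[1]≡0)) ⟩
      evalR (seed ρ ε Q) oneζ           ≡⟨ evalR-at-const (seed ρ ε Q) (+ 1) refl ⟩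
      const (evalℤ (seed ρ ε Q) (+ 1))  ≡⟨ cong const seed[1]≡3 ⟩
      const (+ 3)                       ∎)

    N₁-F : N 1 F ≡ const (+ 3)
    N₁-F = trans (N-cong 1 F (seed ρ ε Q) (agrees-with-seed 1 T-vanishes₁)) (N-by-evaluation 1 (seed ρ ε Q) N₁-seed)

    N′-F : N k′ F ≡ const (+ 3)
    N′-F = trans (N-cong k′ F (seed ρ ε Q) (agrees-with-seed k′ T-vanishes′)) (N-by-evaluation k′ (seed ρ ε Q) N′-seed)

    Nₖ-F : N k F ≡ const (+ 3 * m)
    Nₖ-F = begin
      N k F
        ≡⟨ N-mulR k F (pmul oneMinusX ε) (G5 h)
             (All.map (λ {j} Φ[z]≡0 → glue-at-Φ-root {powR ζ (rootExponent k j)} Φ[z]≡0 ρ ε Q σ t h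
                                                      (evalR-h (powR ζ (rootExponent k j))))
                      (vanishes-by-evaluation k Φ Φ-vanishes)) ⟩
      mulR (N k (pmul oneMinusX ε)) (N k (G5 h))
        ≡⟨ mulR-consts (N-by-evaluation k (pmul oneMinusX ε) Nₖ-factor) (sym m≡Nₖ) ⟩
      const (+ 3 * m) ∎

    M27-F : M27 F ≡ const (+ 81 * m)
    M27-F = begin
      M27 F
        ≡⟨ M27-split k′ k partition F ⟩
      mulR (evalR F oneζ) (mulR (N 1 F) (mulR (N k′ F) (N k F)))
        ≡⟨ mulR-consts (trans (evalR-at-const F (+ 1) refl) (cong const F[1]≡3))
                       (mulR-consts N₁-F (mulR-consts N′-F Nₖ-F)) ⟩
      const (+ 3 * (+ 3 * (+ 3 * (+ 3 * m))))
        ≡⟨ cong const (3⁴*m≡81*m m) ⟩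
      const (+ 81 * m) ∎

-- Witnesses

Φ₉ Φ₂₇ T₂ T₃ : Poly
Φ₉  = + 1 ∷ + 0 ∷ + 0 ∷ + 1 ∷ + 0 ∷ + 0 ∷ + 1 ∷ []
Φ₂₇ = + 1 ∷ + 0 ∷ + 0 ∷ + 0 ∷ + 0 ∷ + 0 ∷ + 0 ∷ + 0 ∷ + 0 ∷
      + 1 ∷ + 0 ∷ + 0 ∷ + 0 ∷ + 0 ∷ + 0 ∷ + 0 ∷ + 0 ∷ + 0 ∷ + 1 ∷ []
T₂  = pmul (- + 1 ∷ + 0 ∷ + 0 ∷ + 1 ∷ []) Φ₂₇
T₃  = - + 1 ∷ + 0 ∷ + 0 ∷ + 0 ∷ + 0 ∷ + 0 ∷ + 0 ∷ + 0 ∷ + 0 ∷ + 1 ∷ []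

level₂ : Level 2 3
level₂ = record
  { Φ  = Φ₉
  ; T  = T₂
  ; Eₛ = + 7 ∷ - + 9 ∷ + 12 ∷ - + 7 ∷ + 3 ∷ + 3 ∷ []
  ; Eₜ = + 0 ∷ + 12 ∷ - + 21 ∷ + 28 ∷ - + 21 ∷ + 12 ∷ []
  ; Qₛ = - + 4 ∷ - + 9 ∷ + 33 ∷ - + 42 ∷ + 42 ∷ - + 42 ∷ + 42 ∷ - + 30 ∷ + 12 ∷ - + 7 ∷ - + 3 ∷ + 18 ∷
      - + 21 ∷ + 21 ∷ - + 21 ∷ + 21 ∷ - + 15 ∷ + 6 ∷ - + 7 ∷ + 3 ∷ + 3 ∷ []
  ; Qₜ = - + 1 ∷ - + 3 ∷ - + 15 ∷ + 57 ∷ - + 90 ∷ + 108 ∷ - + 112 ∷ + 108 ∷ - + 90 ∷ + 56 ∷ - + 30 ∷ + 3 ∷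
      + 28 ∷ - + 45 ∷ + 54 ∷ - + 56 ∷ + 54 ∷ - + 45 ∷ + 28 ∷ - + 21 ∷ + 12 ∷ []
  ; Eₛ-congruence = refl
  ; Eₜ-congruence = refl
  ; T[1]≡0        = refl
  ; Φ-vanishes    = from-yes (vanishes? 2 Φ₉)
  ; T-vanishes₁   = from-yes (vanishes? 1 T₂)
  ; T-vanishes′   = from-yes (vanishes? 3 T₂)
  ; partition     = ↭-by-sorting refl
  }

level₃ : Level 3 2
level₃ = record
  { Φ  = Φ₂₇
  ; T  = T₃
  ; Eₛ = + 2 ∷ - + 12 ∷ + 30 ∷ - + 40 ∷ + 30 ∷ - + 12 ∷ + 2 ∷ + 0 ∷ + 0 ∷ + 1 ∷ - + 6 ∷ + 15 ∷ - + 20 ∷ + 15 ∷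
      - + 6 ∷ + 1 ∷ []
  ; Eₜ = - + 1 ∷ + 6 ∷ - + 24 ∷ + 56 ∷ - + 84 ∷ + 84 ∷ - + 56 ∷ + 24 ∷ - + 6 ∷ + 0 ∷ + 3 ∷ - + 12 ∷ + 28 ∷
      - + 42 ∷ + 42 ∷ - + 28 ∷ + 12 ∷ - + 3 ∷ []
  ; Qₛ = + 1 ∷ - + 6 ∷ + 15 ∷ - + 20 ∷ + 15 ∷ - + 6 ∷ + 1 ∷ []
  ; Qₜ = + 0 ∷ + 3 ∷ - + 12 ∷ + 28 ∷ - + 42 ∷ + 42 ∷ - + 28 ∷ + 12 ∷ - + 3 ∷ []
  ; Eₛ-congruence = refl
  ; Eₜ-congruence = refl
  ; T[1]≡0        = refl
  ; Φ-vanishes    = from-yes (vanishes? 3 Φ₂₇)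
  ; T-vanishes₁   = from-yes (vanishes? 1 T₃)
  ; T-vanishes′   = from-yes (vanishes? 2 T₃)
  ; partition     = ↭-by-sorting refl
  }

module L₂ = Gluing level₂

certificates₂ : L₂.Certificates
certificates₂ 0F _ _ r₀≢0 = ⊥-elim (r₀≢0 refl)
certificates₂ 1F 0F 0F _ = L₂.certificate
  (- + 4 ∷ + 4 ∷ + 11 ∷ + 10 ∷ + 14 ∷ + 11 ∷ [])
  (+ 3 ∷ + 31 ∷ - + 62 ∷ + 104 ∷ - + 33 ∷ + 29 ∷ + 6 ∷ - + 10 ∷ - + 21 ∷ - + 25 ∷ - + 23 ∷ - + 16 ∷ - + 4 ∷
      + 8 ∷ + 15 ∷ + 13 ∷ + 5 ∷ - + 3 ∷ - + 7 ∷ - + 6 ∷ - + 3 ∷ [])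
  refl refl refl refl
certificates₂ 1F 0F 1F _ = L₂.certificate
  (+ 1 ∷ + 4 ∷ + 6 ∷ + 4 ∷ + 1 ∷ [])
  (+ 8 ∷ - + 4 ∷ + 0 ∷ + 20 ∷ + 1 ∷ - + 12 ∷ + 2 ∷ + 1 ∷ - + 9 ∷ - + 14 ∷ - + 6 ∷ + 8 ∷ + 7 ∷ + 2 ∷ - + 1 ∷
      + 3 ∷ + 2 ∷ - + 4 ∷ - + 4 ∷ - + 2 ∷ + 3 ∷ [])
  refl refl refl refl
certificates₂ 1F 0F 2F _ = L₂.certificate
  (- + 39 ∷ - + 25 ∷ + 0 ∷ - + 14 ∷ + 14 ∷ + 35 ∷ [])
  (- + 94 ∷ + 773 ∷ - + 2214 ∷ + 3494 ∷ - + 3123 ∷ + 1808 ∷ - + 476 ∷ + 99 ∷ - + 7 ∷ - + 61 ∷ - + 85 ∷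
      - + 91 ∷ - + 56 ∷ - + 26 ∷ + 8 ∷ + 32 ∷ + 39 ∷ + 30 ∷ - + 7 ∷ - + 19 ∷ - + 23 ∷ [])
  refl refl refl refl
certificates₂ 1F 1F 0F _ = L₂.certificate
  (- + 4 ∷ + 4 ∷ + 11 ∷ + 10 ∷ + 14 ∷ + 11 ∷ [])
  (+ 5 ∷ - + 9 ∷ + 27 ∷ - + 72 ∷ + 89 ∷ - + 50 ∷ + 13 ∷ - + 2 ∷ - + 4 ∷ + 0 ∷ + 3 ∷ + 2 ∷ - + 1 ∷ - + 1 ∷
      + 1 ∷ + 1 ∷ - + 1 ∷ - + 2 ∷ + 0 ∷ + 1 ∷ + 1 ∷ [])
  refl refl refl refl
certificates₂ 1F 1F 1F _ = L₂.certificate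
  (+ 1 ∷ + 4 ∷ + 6 ∷ + 4 ∷ + 1 ∷ [])
  (+ 2 ∷ - + 4 ∷ - + 1 ∷ + 8 ∷ - + 4 ∷ - + 5 ∷ + 5 ∷ + 2 ∷ - + 2 ∷ - + 3 ∷ + 1 ∷ + 3 ∷ + 0 ∷ - + 2 ∷ - + 1 ∷
      + 2 ∷ + 1 ∷ - + 1 ∷ - + 1 ∷ + 0 ∷ + 1 ∷ [])
  refl refl refl refl
certificates₂ 1F 1F 2F _ = L₂.certificate
  (- + 39 ∷ - + 25 ∷ + 0 ∷ - + 14 ∷ + 14 ∷ + 35 ∷ [])
  (- + 39 ∷ + 526 ∷ - + 1588 ∷ + 2574 ∷ - + 2558 ∷ + 1515 ∷ - + 497 ∷ + 66 ∷ - + 2 ∷ + 3 ∷ + 2 ∷ - + 1 ∷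
      - + 2 ∷ + 1 ∷ + 2 ∷ + 0 ∷ - + 2 ∷ - + 1 ∷ + 1 ∷ + 1 ∷ [])
  refl refl refl refl
certificates₂ 1F 2F 0F _ = L₂.certificate
  (- + 4 ∷ + 4 ∷ + 11 ∷ + 10 ∷ + 14 ∷ + 11 ∷ [])
  (+ 9 ∷ - + 44 ∷ + 124 ∷ - + 235 ∷ + 230 ∷ - + 107 ∷ + 34 ∷ + 2 ∷ - + 10 ∷ - + 7 ∷ + 1 ∷ + 3 ∷ - + 2 ∷
      - + 2 ∷ + 4 ∷ + 6 ∷ + 1 ∷ - + 5 ∷ - + 3 ∷ + 0 ∷ + 2 ∷ [])
  refl refl refl refl
certificates₂ 1F 2F 1F _ = L₂.certificate
  (+ 1 ∷ + 4 ∷ + 6 ∷ + 4 ∷ + 1 ∷ [])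
  (- + 3 ∷ - + 4 ∷ + 0 ∷ + 3 ∷ + 1 ∷ + 6 ∷ + 2 ∷ - + 7 ∷ - + 3 ∷ + 3 ∷ + 4 ∷ - + 2 ∷ - + 2 ∷ + 2 ∷ + 4 ∷ + 0 ∷
      - + 4 ∷ - + 2 ∷ + 1 ∷ + 2 ∷ [])
  refl refl refl refl
certificates₂ 1F 2F 2F _ = L₂.certificate
  (- + 39 ∷ - + 25 ∷ + 0 ∷ - + 14 ∷ + 14 ∷ + 35 ∷ [])
  (- + 3 ∷ + 275 ∷ - + 950 ∷ + 1703 ∷ - + 1937 ∷ + 1287 ∷ - + 450 ∷ + 84 ∷ + 12 ∷ + 1 ∷ - + 9 ∷ - + 14 ∷
      - + 8 ∷ - + 2 ∷ + 3 ∷ + 6 ∷ + 7 ∷ + 6 ∷ - + 1 ∷ - + 4 ∷ - + 5 ∷ [])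
  refl refl refl refl
certificates₂ 2F 0F 0F _ = L₂.certificate
  (- + 74 ∷ - + 64 ∷ - + 25 ∷ - + 49 ∷ + 0 ∷ + 49 ∷ [])
  (- + 69 ∷ + 757 ∷ - + 1527 ∷ + 1359 ∷ - + 600 ∷ + 92 ∷ - + 1 ∷ - + 4 ∷ - + 12 ∷ - + 8 ∷ + 1 ∷ + 10 ∷ + 6 ∷
      + 2 ∷ + 0 ∷ + 0 ∷ - + 2 ∷ - + 6 ∷ - + 2 ∷ + 1 ∷ + 4 ∷ [])
  refl refl refl refl
certificates₂ 2F 0F 1F _ = L₂.certificate
  (+ 1 ∷ + 5 ∷ + 10 ∷ + 10 ∷ + 5 ∷ + 1 ∷ [])
  (+ 8 ∷ + 0 ∷ - + 16 ∷ + 10 ∷ + 17 ∷ - + 22 ∷ - + 17 ∷ + 17 ∷ + 20 ∷ - + 3 ∷ - + 17 ∷ - + 2 ∷ + 11 ∷ + 3 ∷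
      - + 11 ∷ - + 7 ∷ + 8 ∷ + 10 ∷ + 1 ∷ - + 6 ∷ - + 3 ∷ [])
  refl refl refl refl
certificates₂ 2F 0F 2F _ = L₂.certificate
  (- + 15 ∷ + 0 ∷ + 15 ∷ + 10 ∷ + 24 ∷ + 25 ∷ [])
  (- + 48 ∷ + 413 ∷ - + 1231 ∷ + 1961 ∷ - + 1872 ∷ + 1094 ∷ - + 368 ∷ + 34 ∷ + 8 ∷ + 16 ∷ + 3 ∷ - + 12 ∷
      - + 2 ∷ + 8 ∷ + 4 ∷ - + 8 ∷ - + 8 ∷ + 4 ∷ + 6 ∷ + 3 ∷ - + 4 ∷ [])
  refl refl refl refl
certificates₂ 2F 1F 0F _ = L₂.certificate
  (- + 74 ∷ - + 64 ∷ - + 25 ∷ - + 49 ∷ + 0 ∷ + 49 ∷ [])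
  (- + 3 ∷ + 297 ∷ - + 405 ∷ - + 94 ∷ + 375 ∷ - + 250 ∷ + 63 ∷ + 26 ∷ + 20 ∷ - + 1 ∷ - + 12 ∷ - + 14 ∷ - + 8 ∷
      - + 7 ∷ - + 2 ∷ + 7 ∷ + 13 ∷ + 10 ∷ - + 2 ∷ - + 6 ∷ - + 6 ∷ [])
  refl refl refl refl
certificates₂ 2F 1F 1F _ = L₂.certificate
  (+ 1 ∷ + 5 ∷ + 10 ∷ + 10 ∷ + 5 ∷ + 1 ∷ [])
  (+ 3 ∷ - + 4 ∷ - + 14 ∷ + 7 ∷ + 17 ∷ - + 6 ∷ - + 9 ∷ + 4 ∷ + 9 ∷ + 0 ∷ - + 8 ∷ - + 4 ∷ + 5 ∷ + 5 ∷ - + 2 ∷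
      - + 4 ∷ + 1 ∷ + 4 ∷ + 1 ∷ - + 2 ∷ - + 2 ∷ [])
  refl refl refl refl
certificates₂ 2F 1F 2F _ = L₂.certificate
  (- + 15 ∷ + 0 ∷ + 15 ∷ + 10 ∷ + 24 ∷ + 25 ∷ [])
  (- + 32 ∷ + 305 ∷ - + 938 ∷ + 1509 ∷ - + 1509 ∷ + 947 ∷ - + 327 ∷ + 48 ∷ + 6 ∷ + 4 ∷ - + 6 ∷ - + 13 ∷
      - + 3 ∷ + 6 ∷ + 6 ∷ + 0 ∷ - + 1 ∷ + 3 ∷ + 1 ∷ - + 1 ∷ - + 4 ∷ [])
  refl refl refl refl
certificates₂ 2F 2F 0F _ = L₂.certificate
  (- + 74 ∷ - + 64 ∷ - + 25 ∷ - + 49 ∷ + 0 ∷ + 49 ∷ [])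
  (+ 40 ∷ - + 163 ∷ + 756 ∷ - + 1437 ∷ + 1482 ∷ - + 468 ∷ + 215 ∷ + 91 ∷ + 28 ∷ - + 100 ∷ - + 163 ∷ - + 181 ∷
      - + 115 ∷ - + 73 ∷ - + 18 ∷ + 38 ∷ + 74 ∷ + 72 ∷ - + 2 ∷ - + 31 ∷ - + 44 ∷ [])
  refl refl refl refl
certificates₂ 2F 2F 1F _ = L₂.certificate
  (+ 1 ∷ + 5 ∷ + 10 ∷ + 10 ∷ + 5 ∷ + 1 ∷ [])
  (+ 4 ∷ + 5 ∷ + 4 ∷ + 12 ∷ + 16 ∷ + 6 ∷ - + 6 ∷ - + 17 ∷ - + 18 ∷ - + 10 ∷ - + 6 ∷ - + 3 ∷ + 3 ∷ + 11 ∷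
      + 11 ∷ + 3 ∷ - + 5 ∷ - + 7 ∷ - + 3 ∷ + 0 ∷ + 1 ∷ [])
  refl refl refl refl
certificates₂ 2F 2F 2F _ = L₂.certificate
  (- + 15 ∷ + 0 ∷ + 15 ∷ + 10 ∷ + 24 ∷ + 25 ∷ [])
  (- + 14 ∷ + 212 ∷ - + 616 ∷ + 1096 ∷ - + 1114 ∷ + 817 ∷ - + 286 ∷ + 48 ∷ - + 23 ∷ - + 48 ∷ - + 55 ∷ - + 43 ∷
      - + 13 ∷ + 8 ∷ + 21 ∷ + 24 ∷ + 19 ∷ + 6 ∷ - + 12 ∷ - + 15 ∷ - + 11 ∷ [])
  refl refl refl refl

module L₃ = Gluing level₃

certificates₃ : L₃.Certificates
certificates₃ 0F _ _ r₀≢0 = ⊥-elim (r₀≢0 refl)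
certificates₃ 1F 0F 0F _ = L₃.certificate
  (+ 0 ∷ + 0 ∷ + 1 ∷ + 2 ∷ + 2 ∷ + 2 ∷ + 1 ∷ [])
  (+ 0 ∷ + 2 ∷ - + 1 ∷ - + 1 ∷ + 2 ∷ + 0 ∷ - + 2 ∷ + 3 ∷ - + 2 ∷ [])
  refl refl refl refl
certificates₃ 1F 0F 1F _ = L₃.certificate
  (+ 0 ∷ + 0 ∷ + 1 ∷ + 1 ∷ [])
  (+ 7 ∷ - + 2 ∷ + 1 ∷ - + 4 ∷ + 10 ∷ - + 11 ∷ + 3 ∷ + 8 ∷ - + 11 ∷ [])
  refl refl refl refl
certificates₃ 1F 0F 2F _ = L₃.certificate
  (+ 0 ∷ + 1 ∷ + 3 ∷ + 5 ∷ + 7 ∷ + 9 ∷ + 9 ∷ + 7 ∷ + 5 ∷ + 3 ∷ + 1 ∷ [])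
  (+ 6 ∷ + 10 ∷ - + 16 ∷ + 9 ∷ + 3 ∷ - + 7 ∷ + 0 ∷ + 12 ∷ - + 16 ∷ [])
  refl refl refl refl
certificates₃ 1F 1F 0F _ = L₃.certificate
  (+ 1 ∷ + 5 ∷ + 11 ∷ + 15 ∷ + 16 ∷ + 15 ∷ + 11 ∷ + 5 ∷ + 1 ∷ [])
  (- + 1 ∷ - + 3 ∷ + 0 ∷ - + 1 ∷ + 0 ∷ + 2 ∷ - + 1 ∷ + 1 ∷ + 4 ∷ [])
  refl refl refl refl
certificates₃ 1F 1F 1F _ = L₃.certificate
  (- + 1 ∷ - + 4 ∷ - + 8 ∷ - + 12 ∷ - + 16 ∷ - + 20 ∷ - + 24 ∷ - + 26 ∷ - + 24 ∷ - + 20 ∷ - + 16 ∷ - + 12 ∷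
      - + 8 ∷ - + 4 ∷ - + 1 ∷ [])
  (+ 2 ∷ + 2 ∷ - + 5 ∷ + 2 ∷ + 3 ∷ - + 3 ∷ + 2 ∷ + 2 ∷ - + 4 ∷ [])
  refl refl refl refl
certificates₃ 1F 1F 2F _ = L₃.certificate
  (+ 1 ∷ + 6 ∷ + 17 ∷ + 32 ∷ + 47 ∷ + 57 ∷ + 57 ∷ + 47 ∷ + 32 ∷ + 17 ∷ + 6 ∷ + 1 ∷ [])
  (+ 8 ∷ + 6 ∷ - + 11 ∷ + 2 ∷ + 1 ∷ - + 14 ∷ + 5 ∷ + 9 ∷ - + 5 ∷ [])
  refl refl refl refl
certificates₃ 1F 2F 0F _ = L₃.certificate
  (+ 1 ∷ + 5 ∷ + 14 ∷ + 30 ∷ + 55 ∷ + 87 ∷ + 120 ∷ + 148 ∷ + 165 ∷ + 165 ∷ + 148 ∷ + 120 ∷ + 87 ∷ + 55 ∷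
      + 30 ∷ + 14 ∷ + 5 ∷ + 1 ∷ [])
  (+ 1 ∷ + 1 ∷ + 12 ∷ + 4 ∷ - + 3 ∷ + 2 ∷ - + 8 ∷ - + 9 ∷ + 1 ∷ [])
  refl refl refl refl
certificates₃ 1F 2F 1F _ = L₃.certificate
  (+ 0 ∷ + 1 ∷ + 4 ∷ + 9 ∷ + 16 ∷ + 24 ∷ + 30 ∷ + 32 ∷ + 30 ∷ + 24 ∷ + 16 ∷ + 9 ∷ + 4 ∷ + 1 ∷ [])
  (+ 4 ∷ + 2 ∷ + 0 ∷ + 2 ∷ - + 3 ∷ - + 3 ∷ + 0 ∷ - + 1 ∷ [])
  refl refl refl refl
certificates₃ 1F 2F 2F _ = L₃.certificate
  (- + 19 ∷ + 0 ∷ + 19 ∷ + 50 ∷ + 104 ∷ + 186 ∷ + 292 ∷ + 410 ∷ + 520 ∷ + 578 ∷ + 620 ∷ + 597 ∷ + 520 ∷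
      + 410 ∷ + 292 ∷ + 186 ∷ + 104 ∷ + 50 ∷ [])
  (- + 10 ∷ + 135 ∷ - + 536 ∷ + 1096 ∷ - + 1334 ∷ + 1076 ∷ - + 485 ∷ + 85 ∷ - + 26 ∷ [])
  refl refl refl refl
certificates₃ 2F 0F 0F _ = L₃.certificate
  (- + 2107 ∷ - + 1639 ∷ - + 1178 ∷ - + 751 ∷ - + 363 ∷ + 0 ∷ + 363 ∷ + 751 ∷ + 1178 ∷ - + 468 ∷ + 468 ∷
      + 1356 ∷ + 2107 ∷ + 2653 ∷ + 2957 ∷ + 3016 ∷ + 2858 ∷ + 2534 ∷ [])
  (- + 2119 ∷ + 21540 ∷ - + 46344 ∷ + 47361 ∷ - + 25006 ∷ + 4841 ∷ - + 149 ∷ - + 84 ∷ - + 39 ∷ [])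
  refl refl refl refl
certificates₃ 2F 0F 1F _ = L₃.certificate
  (- + 25 ∷ - + 12 ∷ + 0 ∷ + 12 ∷ + 25 ∷ + 41 ∷ + 61 ∷ + 85 ∷ + 110 ∷ + 105 ∷ + 129 ∷ + 141 ∷ + 141 ∷ + 130 ∷
      + 110 ∷ + 85 ∷ + 61 ∷ + 41 ∷ [])
  (- + 39 ∷ + 452 ∷ - + 1227 ∷ + 1744 ∷ - + 1519 ∷ + 821 ∷ - + 264 ∷ + 43 ∷ - + 10 ∷ [])
  refl refl refl refl
certificates₃ 2F 0F 2F _ = L₃.certificate
  (- + 212 ∷ - + 139 ∷ - + 78 ∷ - + 25 ∷ + 25 ∷ + 78 ∷ + 139 ∷ + 212 ∷ + 297 ∷ + 174 ∷ + 327 ∷ + 444 ∷ + 516 ∷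
      + 541 ∷ + 522 ∷ + 466 ∷ + 386 ∷ + 297 ∷ [])
  (- + 623 ∷ + 5311 ∷ - + 14722 ∷ + 22329 ∷ - + 20857 ∷ + 11959 ∷ - + 3982 ∷ + 604 ∷ - + 18 ∷ [])
  refl refl refl refl
certificates₃ 2F 1F 0F _ = L₃.certificate
  (- + 6 ∷ + 6 ∷ + 26 ∷ + 70 ∷ + 152 ∷ + 278 ∷ + 440 ∷ + 614 ∷ + 763 ∷ + 842 ∷ + 848 ∷ + 763 ∷ + 614 ∷ + 440 ∷
      + 278 ∷ + 152 ∷ + 70 ∷ + 26 ∷ [])
  (- + 15 ∷ + 35 ∷ - + 38 ∷ + 54 ∷ + 64 ∷ - + 54 ∷ + 11 ∷ - + 27 ∷ - + 29 ∷ [])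
  refl refl refl refl
certificates₃ 2F 1F 1F _ = L₃.certificate
  (+ 1 ∷ + 5 ∷ + 13 ∷ + 25 ∷ + 40 ∷ + 54 ∷ + 62 ∷ + 62 ∷ + 54 ∷ + 40 ∷ + 25 ∷ + 13 ∷ + 5 ∷ + 1 ∷ [])
  (+ 9 ∷ + 2 ∷ - + 3 ∷ + 4 ∷ - + 5 ∷ - + 7 ∷ + 3 ∷ + 0 ∷ - + 2 ∷ [])
  refl refl refl refl
certificates₃ 2F 1F 2F _ = L₃.certificate
  (+ 1 ∷ + 6 ∷ + 19 ∷ + 44 ∷ + 83 ∷ + 132 ∷ + 181 ∷ + 218 ∷ + 232 ∷ + 218 ∷ + 181 ∷ + 132 ∷ + 83 ∷ + 44 ∷
      + 19 ∷ + 6 ∷ + 1 ∷ [])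
  (+ 15 ∷ + 6 ∷ + 3 ∷ + 19 ∷ - + 5 ∷ - + 14 ∷ + 0 ∷ - + 13 ∷ - + 10 ∷ [])
  refl refl refl refl
certificates₃ 2F 2F 0F _ = L₃.certificate
  (+ 1 ∷ + 4 ∷ + 8 ∷ + 12 ∷ + 16 ∷ + 18 ∷ + 16 ∷ + 12 ∷ + 8 ∷ + 4 ∷ + 1 ∷ [])
  (- + 5 ∷ + 2 ∷ + 2 ∷ - + 3 ∷ + 2 ∷ + 2 ∷ - + 3 ∷ + 2 ∷ + 2 ∷ [])
  refl refl refl refl
certificates₃ 2F 2F 1F _ = L₃.certificate
  (+ 0 ∷ + 1 ∷ + 2 ∷ + 1 ∷ [])
  (+ 2 ∷ - + 1 ∷ - + 1 ∷ + 2 ∷ + 0 ∷ - + 2 ∷ + 3 ∷ - + 2 ∷ [])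
  refl refl refl refl
certificates₃ 2F 2F 2F _ = L₃.certificate
  (+ 0 ∷ + 1 ∷ + 3 ∷ + 4 ∷ + 4 ∷ + 3 ∷ + 1 ∷ [])
  (+ 9 ∷ - + 6 ∷ - + 2 ∷ + 7 ∷ - + 2 ∷ - + 6 ∷ + 9 ∷ - + 4 ∷ - + 4 ∷ [])
  refl refl refl refl

lemma4p5 : (m : ℤ) →
    ((Σ Poly λ h → ¬ (+ 3 ∣ evalℤ h (+ 1)) × const m ≡ N 2 (G5 h)) →
      Σ Poly λ F → evalℤ F (+ 1) ≡ + 3 × N 1 F ≡ const (+ 3) × N 3 F ≡ const (+ 3)
        × N 2 F ≡ const (+ 3 * m) × M27 F ≡ const (+ 81 * m))
    × ((Σ Poly λ h → ¬ (+ 3 ∣ evalℤ h (+ 1)) × const m ≡ N 3 (G5 h)) →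
      Σ Poly λ F → evalℤ F (+ 1) ≡ + 3 × N 1 F ≡ const (+ 3) × N 2 F ≡ const (+ 3)
        × N 3 F ≡ const (+ 3 * m) × M27 F ≡ const (+ 81 * m))
lemma4p5 m = L₂.realise certificates₂ m , L₃.realise certificates₃ m
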